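{- The family of finite modular vi-lattices is 2-summable.
   Context: A vi-lattice is a lattice that is not a vertical sum (top of one identified with the bottom of the other) of two non-singleton lattices. Vertical 2-sum: for disjoint finite lattices $L,U$ of length at least 3, $L$ with exactly two coatoms $c_1,c_2$ and $U$ with exactly two atoms $a_1,a_2$, the two vertical 2-sums are obtained by removing the top of $L$ and the bottom of $U$ and identifying $(c_1,c_2)$ with $(a_1,a_2)$ or with $(a_2,a_1)$. A family $\mathcal{F}$ of graded vi-lattices is 2-summable if (C1) whenever $L,U\in\mathcal{F}$ and $S$ is one of their vertical 2-sums, $S\in\mathcal{F}$; and (C2) whenever $S\in\mathcal{F}$ is a vertical 2-sum of $L$ and $U$, then $L,U\in\mathcal{F}$. -}

module Defs where

open import Data.Nat using (ℕ; suc)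
open import Data.Fin using (Fin)
open import Data.Product using (Σ; _×_; _,_)
open import Data.Sum using (_⊎_)
open import Data.Empty using (⊥)
open import Relation.Nullary using (¬_)
open import Relation.Binary.PropositionalEquality using (_≡_; _≢_)
open import Function.Bundles using (_↔_)
import Relation.Binary.Lattice.Structures as LS

record RelStr : Set₁ where
  field
    Carrier : Set
    _≤_     : Carrier → Carrier → Set

open RelStr public

module _ (S : RelStr) where
  private
    C = Carrier S
    _⊑_ = _≤_ S

  _<ₛ_ : C → C → Set
  x <ₛ y = x ⊑ y × x ≢ y

  _⋖ₛ_ : C → C → Set
  x ⋖ₛ y = x <ₛ y × (∀ z → x <ₛ z → z <ₛ y → ⊥)

  Finite : Set
  Finite = Σ ℕ λ n → C ↔ Fin n

  record IsLatticeStr : Set where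
    field
      _∨_ : C → C → C
      _∧_ : C → C → C
      isLattice : LS.IsLattice _≡_ _⊑_ _∨_ _∧_

  Modular : IsLatticeStr → Set
  Modular lat = ∀ x y z → x ⊑ z → (x ∨ (y ∧ z)) ≡ ((x ∨ y) ∧ z)
    where open IsLatticeStr lat

  Length≥3 : Set
  Length≥3 = Σ C λ x₀ → Σ C λ x₁ → Σ C λ x₂ → Σ C λ x₃ →
               x₀ <ₛ x₁ × x₁ <ₛ x₂ × x₂ <ₛ x₃

  -- S is the vertical sum of two non-singleton lattices, i.e. of the
  -- intervals [0,z] and [z,1] for some z comparable with every element
  -- and different from the bottom and the top.
  IsVerticalSum : Set
  IsVerticalSum = Σ C λ z → (∀ x → x ⊑ z ⊎ z ⊑ x)
                    × (Σ C λ x → x <ₛ z) × (Σ C λ x → z <ₛ x)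

  VI : Set
  VI = IsLatticeStr × ¬ IsVerticalSum

  Graded : Set
  Graded = Σ (C → ℕ) λ ρ → ∀ x y → x ⋖ₛ y → ρ y ≡ suc (ρ x)

-- The sum identifies c₁ with a₁ and c₂ with a₂; the other
-- vertical 2-sum is obtained from the data with a₁, a₂ swapped.

record VSumData (L U : RelStr) : Set where
  field
    L-fin : Finite L
    U-fin : Finite U
    L-lat : IsLatticeStr L
    U-lat : IsLatticeStr U
    L-len : Length≥3 L
    U-len : Length≥3 U
    top   : Carrier L
    top-max : ∀ x → _≤_ L x top
    bot   : Carrier U
    bot-min : ∀ y → _≤_ U bot y
    c₁ c₂ : Carrier L
    c₁-coatom : _⋖ₛ_ L c₁ top
    c₂-coatom : _⋖ₛ_ L c₂ top
    c₁≢c₂ : c₁ ≢ c₂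
    only-coatoms : ∀ c → _⋖ₛ_ L c top → c ≡ c₁ ⊎ c ≡ c₂
    a₁ a₂ : Carrier U
    a₁-atom : _⋖ₛ_ U bot a₁
    a₂-atom : _⋖ₛ_ U bot a₂
    a₁≢a₂ : a₁ ≢ a₂
    only-atoms : ∀ a → _⋖ₛ_ U bot a → a ≡ a₁ ⊎ a ≡ a₂

module _ {L U : RelStr} (d : VSumData L U) where
  open VSumData d

  -- elements: L minus its top, and U minus its bottom and its two atoms
  -- (the atoms aᵢ of U being identified with the coatoms cᵢ of L)
  data VCar : Set where
    low  : (x : Carrier L) → .(x ≢ top) → VCar
    high : (y : Carrier U) → .(y ≢ bot) → .(y ≢ a₁) → .(y ≢ a₂) → VCar

  data _≼_ : VCar → VCar → Set where
    ll  : ∀ {x x'} .{p p'} → _≤_ L x x' → low x p ≼ low x' p'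
    hh  : ∀ {y y'} .{p q r p' q' r'} → _≤_ U y y' →
            high y p q r ≼ high y' p' q' r'
    lh₁ : ∀ {x y} .{p p' q' r'} → _≤_ L x c₁ → _≤_ U a₁ y →
            low x p ≼ high y p' q' r'
    lh₂ : ∀ {x y} .{p p' q' r'} → _≤_ L x c₂ → _≤_ U a₂ y →
            low x p ≼ high y p' q' r'

  VSum : RelStr
  VSum = record { Carrier = VCar ; _≤_ = _≼_ }

record TwoSummable (F : RelStr → Set) : Set₁ where
  field
    members-vi     : ∀ S → F S → VI S
    members-graded : ∀ S → F S → Graded S
    C1 : ∀ L U (d : VSumData L U) → F L → F U → F (VSum d)
    C2 : ∀ L U (d : VSumData L U) → F (VSum d) → F L × F U

FinModVI : RelStr → Set
FinModVI S = Finite S × (Σ (IsLatticeStr S) λ lat → Modular S lat) × VI S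

-- A finite modular lattice is graded by its height function. If the height of y is
-- attained through the lower cover w and x is another lower cover of y, the modular law
-- makes x ∧ w a lower cover of w; by induction on the height, x ∧ w lies two steps
-- below y, and x, lying strictly above x ∧ w, lies exactly one step below y.
--
-- In a vertical 2-sum S of L and U the order between the two halves is governed by a
-- Galois connection φ ⊣ ψ : L ⇄ U (φ x ⊑ y iff x ⊑ ψ y iff x lies below y in S).
-- L and U embed into S as sublattices, so modularity of S passes to L and U.
-- Conversely, the modular law in S reduces, case by case on where the three elements
-- lie, to the modular laws of L and U and to the identities ψ (φ x ∨ y) = x ∨ ψ y and
-- φ (x ∧ ψ y) = φ x ∧ y (for x ≠ top), which hold because c₁, c₂ are the only coatoms
-- of L and a₁, a₂ the only atoms of U. A splitting element of S is one of L or U, and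
-- conversely, so S is a vi-lattice exactly when L and U are.

module Submission where

open import Defs renaming (_≼_ to _≼ᵈ_)
open import Data.Nat using (ℕ; zero; suc; _+_; z≤n; s≤s) renaming (_≤_ to _≤ℕ_; _<_ to _<ℕ_)
import Data.Nat.Properties as ℕ
open import Data.Fin using (Fin)
import Data.Fin.Properties as Fin
open import Data.List using (List; []; _∷_; map; filter; length; allFin)
open import Data.List.Properties using (filter-notAll; filter-reject; map-cong-local)
open import Data.List.Extrema.Nat using (argmax; argmax-all; f[xs]≤f[argmax]; max; xs≤max; argmax-sel)
open import Data.List.Membership.Propositional using (_∈_)
open import Data.List.Membership.Propositional.Properties using (∈-map⁺; ∈-map⁻; ∈-filter⁺; ∈-filter⁻; ∈-allFin)
open import Data.List.Relation.Unary.All as All using (All)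
open import Data.List.Relation.Unary.All.Properties using (all-filter)
import Data.List.Relation.Unary.Any as Any
open import Data.Product using (Σ; _×_; _,_; proj₁; proj₂)
open import Data.Sum using (_⊎_; inj₁; inj₂; [_,_]′)
import Data.Sum as Sum
open import Data.Sum.Function.Propositional using (_⊎-↔_)
open import Data.Empty using (⊥; ⊥-elim; ⊥-elim-irr)
open import Data.Unit using (⊤; tt)
open import Data.Refinement using (Refinement-syntax; _,_)
open import Data.Irrelevant using ([_])
open import Function using (_∘_; flip; _↔_; Inverse)
open import Function.Bundles using (mk↔ₛ′)
open import Function.Properties.Inverse using (↔⇒↣; ↔-trans; ↔-sym)
open import Relation.Nullary using (¬_; Dec; yes; no; _×-dec_; ¬?)
open import Relation.Nullary.Decidable using (via-injection)
open import Relation.Nullary.Recomputable using (¬-recompute)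
open import Relation.Unary using (Decidable)
open import Relation.Binary.PropositionalEquality using (_≡_; _≢_; refl; sym; trans; cong; cong₂; subst; isEquivalence; module ≡-Reasoning)
import Relation.Binary.Lattice.Structures as LS
open import Relation.Binary.Lattice.Bundles using (Lattice)
import Relation.Binary.Lattice.Properties.Lattice as LatticeProperties
import Relation.Binary.Lattice.Properties.JoinSemilattice as JoinProperties
import Relation.Binary.Lattice.Properties.MeetSemilattice as MeetProperties

-- Finite types

refinement-↔ : ∀ {A B : Set} {P : A → Set} (e : A ↔ B) →
               [ a ∈ A ∣ P a ] ↔ [ b ∈ B ∣ P (Inverse.from e b) ]
refinement-↔ {P = P} e = mk↔ₛ′
  (λ (a , [ pa ]) → E.to a , [ subst P (sym (E.strictlyInverseʳ a)) pa ])
  (λ (b , [ pb ]) → E.from b , [ pb ])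
  (λ (b , _) → cong-refined (E.strictlyInverseˡ b))
  (λ (a , _) → cong-refined (E.strictlyInverseʳ a))
  where
    module E = Inverse e
    cong-refined : ∀ {C : Set} {Q : C → Set} {c d} .{qc : Q c} .{qd : Q d} →
                   c ≡ d → _≡_ {A = [ x ∈ C ∣ Q x ]} (c , [ qc ]) (d , [ qd ])
    cong-refined refl = refl

Fin-suc-refinement : ∀ {n} (P : Fin (suc n) → Set) →
  [ i ∈ Fin (suc n) ∣ P i ] ↔ ([ _ ∈ ⊤ ∣ P Fin.zero ] ⊎ [ i ∈ Fin n ∣ P (Fin.suc i) ])
Fin-suc-refinement P = mk↔ₛ′ to from
  (λ { (inj₁ _) → refl ; (inj₂ _) → refl })
  (λ { (Fin.zero , _) → refl ; (Fin.suc _ , _) → refl })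
  where
    to : [ i ∈ Fin _ ∣ P i ] → [ _ ∈ ⊤ ∣ P Fin.zero ] ⊎ [ i ∈ Fin _ ∣ P (Fin.suc i) ]
    to (Fin.zero  , [ p ]) = inj₁ (tt , [ p ])
    to (Fin.suc i , [ p ]) = inj₂ (i , [ p ])
    from : [ _ ∈ ⊤ ∣ P Fin.zero ] ⊎ [ i ∈ Fin _ ∣ P (Fin.suc i) ] → [ i ∈ Fin _ ∣ P i ]
    from (inj₁ (_ , [ p ])) = Fin.zero , [ p ]
    from (inj₂ (i , [ p ])) = Fin.suc i , [ p ]

unit-refinement : ∀ {Q : Set} → Dec Q → Σ ℕ λ k → [ _ ∈ ⊤ ∣ Q ] ↔ Fin k
unit-refinement (yes q) = 1 , mk↔ₛ′ (λ _ → Fin.zero) (λ _ → tt , [ q ]) (λ { Fin.zero → refl ; (Fin.suc ()) }) (λ _ → refl)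
unit-refinement (no ¬q) = 0 , mk↔ₛ′ (λ (_ , [ q ]) → ⊥-elim-irr (¬q q)) (λ ()) (λ ()) (λ (_ , [ q ]) → ⊥-elim-irr (¬q q))

Fin-refinement : ∀ n (P : Fin n → Set) → Decidable P → Σ ℕ λ k → [ i ∈ Fin n ∣ P i ] ↔ Fin k
Fin-refinement zero P P? = 0 , mk↔ₛ′ (λ { (() , _) }) (λ ()) (λ ()) (λ { (() , _) })
Fin-refinement (suc n) P P?
  with j , head ← unit-refinement (P? Fin.zero)
     | k , rest ← Fin-refinement n (P ∘ Fin.suc) (P? ∘ Fin.suc)
  = j + k , ↔-trans (Fin-suc-refinement P) (↔-trans (head ⊎-↔ rest) (↔-sym Fin.+↔⊎))

refinement-finite : ∀ {A : Set} {n} {P : A → Set} → A ↔ Fin n → Decidable P →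
                    Σ ℕ λ k → [ a ∈ A ∣ P a ] ↔ Fin k
refinement-finite {n = n} {P} e P? with k , e′ ← Fin-refinement n _ (P? ∘ Inverse.from e) =
  k , ↔-trans (refinement-↔ e) e′

module _ {A : Set} {P Q : A → Set} (P? : Decidable P) (Q? : Decidable Q)
         (P⇒Q : ∀ {x} → P x → Q x) where

  filter-absorbs : ∀ xs → filter P? (filter Q? xs) ≡ filter P? xs
  filter-absorbs [] = refl
  filter-absorbs (x ∷ xs) with Q? x
  ... | yes _ with P? x
  ...   | yes _ = cong (x ∷_) (filter-absorbs xs)
  ...   | no _  = filter-absorbs xs
  filter-absorbs (x ∷ xs) | no ¬qx =
    trans (filter-absorbs xs) (sym (filter-reject P? (¬qx ∘ P⇒Q)))

  length-filter-< : ∀ {z} xs → z ∈ xs → Q z → ¬ P z →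
                    length (filter P? xs) <ℕ length (filter Q? xs)
  length-filter-< xs z∈xs qz ¬pz =
    subst (_<ℕ length (filter Q? xs)) (cong length (filter-absorbs xs))
      (filter-notAll P? (filter Q? xs) (Any.map (λ { refl → ¬pz }) (∈-filter⁺ Q? z∈xs qz)))

-- Lattices

Dual : RelStr → RelStr
Dual S = record { Carrier = Carrier S ; _≤_ = flip (_≤_ S) }

⋖-dual : ∀ {S : RelStr} {x y} → _⋖ₛ_ S x y → _⋖ₛ_ (Dual S) y x
⋖-dual ((x≤y , x≢y) , cover) =
  (x≤y , x≢y ∘ sym) , λ z (z≤y , y≢z) (x≤z , z≢x) → cover z (x≤z , z≢x ∘ sym) (z≤y , y≢z ∘ sym)

module LatticeTheory {S : RelStr} (lat : IsLatticeStr S) where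

  open IsLatticeStr lat public
  open LS.IsLattice isLattice public
    using (x≤x∨y; y≤x∨y; ∨-least; x∧y≤x; x∧y≤y; ∧-greatest)
    renaming (refl to ⊑-refl; trans to ⊑-trans; antisym to ⊑-antisym; reflexive to ⊑-reflexive)

  infix 4 _⊑_ _⊏_ _⋖_
  _⊑_ _⊏_ _⋖_ : Carrier S → Carrier S → Set
  _⊑_ = _≤_ S
  _⊏_ = _<ₛ_ S
  _⋖_ = _⋖ₛ_ S

  lattice : Lattice _ _ _
  lattice = record { _≈_ = _≡_ ; _≤_ = _⊑_ ; _∨_ = _∨_ ; _∧_ = _∧_ ; isLattice = isLattice }

  open JoinProperties (Lattice.joinSemilattice lattice) public
    using (∨-comm; x≤y⇒x∨y≈y; ≈-dec⇒≤-dec)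
  open MeetProperties (Lattice.meetSemilattice lattice) public
    using (∧-comm; ∧-idempotent; y≤x⇒x∧y≈y)

  dual : IsLatticeStr (Dual S)
  dual = record { _∨_ = _∧_ ; _∧_ = _∨_ ; isLattice = LatticeProperties.∧-∨-isLattice lattice }

  ⊏-⊑-trans : ∀ {x y z} → x ⊏ y → y ⊑ z → x ⊏ z
  ⊏-⊑-trans (x⊑y , x≢y) y⊑z = ⊑-trans x⊑y y⊑z , λ { refl → x≢y (⊑-antisym x⊑y y⊑z) }

  ⋖-incomparable : ∀ {x y z} → x ⋖ z → y ⋖ z → x ≢ y → ¬ x ⊑ y
  ⋖-incomparable (_ , x-cover) (y⊏z , _) x≢y x⊑y = x-cover _ (x⊑y , x≢y) y⊏z

module _ {S : RelStr} (lat lat′ : IsLatticeStr S) where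

  private
    module A = LatticeTheory lat
    module B = LatticeTheory lat′

  ∨-unique : ∀ x y → x A.∨ y ≡ x B.∨ y
  ∨-unique x y = A.⊑-antisym (A.∨-least (B.x≤x∨y x y) (B.y≤x∨y x y)) (B.∨-least (A.x≤x∨y x y) (A.y≤x∨y x y))

  ∧-unique : ∀ x y → x A.∧ y ≡ x B.∧ y
  ∧-unique x y = A.⊑-antisym (B.∧-greatest (A.x∧y≤x x y) (A.x∧y≤y x y)) (A.∧-greatest (B.x∧y≤x x y) (B.x∧y≤y x y))

  modular-irrelevant : Modular S lat → Modular S lat′
  modular-irrelevant modular x y z x⊑z = begin
    x B.∨ (y B.∧ z)   ≡⟨ sym (trans (cong (x A.∨_) (∧-unique y z)) (∨-unique x (y B.∧ z))) ⟩
    x A.∨ (y A.∧ z)   ≡⟨ modular x y z x⊑z ⟩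
    (x A.∨ y) A.∧ z   ≡⟨ trans (cong (A._∧ z) (∨-unique x y)) (∧-unique (x B.∨ y) z) ⟩
    (x B.∨ y) B.∧ z   ∎
    where open ≡-Reasoning

module _ {A B : RelStr} (latA : IsLatticeStr A) (latB : IsLatticeStr B) where

  private
    module A = LatticeTheory latA
    module B = LatticeTheory latB

  modular-sublattice : (f : Carrier A → Carrier B) (g : Carrier B → Carrier A) → (∀ x → g (f x) ≡ x) →
                       (∀ x y → f (x A.∨ y) ≡ f x B.∨ f y) → (∀ x y → f (x A.∧ y) ≡ f x B.∧ f y) →
                       Modular B latB → Modular A latA
  modular-sublattice f g g∘f f-∨ f-∧ modular x y z x⊑z = begin
    x A.∨ (y A.∧ z)            ≡⟨ sym (g∘f _) ⟩
    g (f (x A.∨ (y A.∧ z)))    ≡⟨ cong g (trans (f-∨ x _) (cong (f x B.∨_) (f-∧ y z))) ⟩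
    g (f x B.∨ (f y B.∧ f z))  ≡⟨ cong g (modular (f x) (f y) (f z) fx⊑fz) ⟩
    g ((f x B.∨ f y) B.∧ f z)  ≡⟨ cong g (sym (trans (f-∧ _ z) (cong (B._∧ f z) (f-∨ x y)))) ⟩
    g (f ((x A.∨ y) A.∧ z))    ≡⟨ g∘f _ ⟩
    (x A.∨ y) A.∧ z            ∎
    where
      open ≡-Reasoning
      fx⊑fz : f x B.⊑ f z
      fx⊑fz = B.⊑-trans (B.x≤x∨y (f x) (f z))
        (B.⊑-reflexive (trans (sym (f-∨ x z)) (cong f (A.x≤y⇒x∨y≈y x⊑z))))

-- Finite lattices

module FiniteLattice {S : RelStr} (lat : IsLatticeStr S) (fin : Finite S) where

  open LatticeTheory lat public
  private
    module E = Inverse (proj₂ fin)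

  _≟_ : (x y : Carrier S) → Dec (x ≡ y)
  _≟_ = via-injection (↔⇒↣ (proj₂ fin)) Fin._≟_

  _⊑?_ : (x y : Carrier S) → Dec (x ⊑ y)
  _⊑?_ = ≈-dec⇒≤-dec _≟_

  _⊏?_ : (x y : Carrier S) → Dec (x ⊏ y)
  x ⊏? y = x ⊑? y ×-dec ¬? (x ≟ y)

  elements : List (Carrier S)
  elements = map E.from (allFin (proj₁ fin))

  ∈-elements : ∀ x → x ∈ elements
  ∈-elements x = subst (_∈ elements) (E.strictlyInverseʳ x) (∈-map⁺ E.from (∈-allFin (E.to x)))

  ⋖-between : ∀ {x y t} → x ⋖ y → x ⊑ t → t ⊑ y → t ≡ x ⊎ t ≡ y
  ⋖-between {x} {y} {t} (_ , cover) x⊑t t⊑y with t ≟ x | t ≟ y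
  ... | yes t≡x | _       = inj₁ t≡x
  ... | no _    | yes t≡y = inj₂ t≡y
  ... | no t≢x  | no t≢y  = ⊥-elim (cover t (x⊑t , t≢x ∘ sym) (t⊑y , t≢y))

  ⋖-∨ : ∀ {c x y} → c ⋖ y → x ⊑ y → ¬ x ⊑ c → x ∨ c ≡ y
  ⋖-∨ c⋖y x⊑y x⋢c with ⋖-between c⋖y (y≤x∨y _ _) (∨-least x⊑y (proj₁ (proj₁ c⋖y)))
  ... | inj₁ x∨c≡c = ⊥-elim (x⋢c (⊑-trans (x≤x∨y _ _) (⊑-reflexive x∨c≡c)))
  ... | inj₂ x∨c≡y = x∨c≡y

  #below : Carrier S → ℕ
  #below x = length (filter (_⊏? x) elements)

  #below-mono : ∀ {x y} → x ⊏ y → #below x <ℕ #below y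
  #below-mono {x} {y} x⊏y =
    length-filter-< (_⊏? x) (_⊏? y) (λ z⊏x → ⊏-⊑-trans z⊏x (proj₁ x⊏y))
      elements (∈-elements x) x⊏y (λ (_ , x≢x) → x≢x refl)

  ∃-maximal : (P : Carrier S → Set) → Decidable P → ∀ {x} → P x →
            Σ (Carrier S) λ m → P m × (∀ {y} → P y → ¬ m ⊏ y)
  ∃-maximal P P? {x} px = m , argmax-all #below px (all-filter P? elements) , m-maximal
    where
      m : Carrier S
      m = argmax #below x (filter P? elements)
      m-maximal : ∀ {y} → P y → ¬ m ⊏ y
      m-maximal py m⊏y = ℕ.<⇒≱ (#below-mono m⊏y)
        (All.lookup (f[xs]≤f[argmax] x (filter P? elements)) (∈-filter⁺ P? (∈-elements _) py))

  coatom-above : ∀ {t} → (∀ x → x ⊑ t) → ∀ x → x ≢ t → Σ (Carrier S) λ c → x ⊑ c × c ⋖ t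
  coatom-above {t} t-max x x≢t = c , x⊑c , (t-max c , c≢t) , c-cover
    where
      P : Carrier S → Set
      P e = x ⊑ e × e ≢ t
      found : Σ (Carrier S) λ m → P m × (∀ {y} → P y → ¬ m ⊏ y)
      found = ∃-maximal P (λ e → x ⊑? e ×-dec ¬? (e ≟ t)) (⊑-refl , x≢t)
      c : Carrier S
      c = proj₁ found
      x⊑c : x ⊑ c
      x⊑c = proj₁ (proj₁ (proj₂ found))
      c≢t : c ≢ t
      c≢t = proj₂ (proj₁ (proj₂ found))
      c-cover : ∀ z → c ⊏ z → z ⊏ t → ⊥
      c-cover z c⊏z z⊏t = proj₂ (proj₂ found) (⊑-trans x⊑c (proj₁ c⊏z) , proj₂ z⊏t) c⊏z

  -- height k x is the length of the longest chain ending at x once the fuel k exceeds #below x.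
  height : ℕ → Carrier S → ℕ
  height zero    _ = 0
  height (suc k) x = max 0 (map (suc ∘ height k) (filter (_⊏? x) elements))

  height-stable : ∀ {k k′} x → #below x <ℕ k → #below x <ℕ k′ → height k x ≡ height k′ x
  height-stable {suc k} {suc k′} x (s≤s b≤k) (s≤s b≤k′) =
    cong (max 0) (map-cong-local (All.map stable (all-filter (_⊏? x) elements)))
    where
      stable : ∀ {y} → y ⊏ x → suc (height k y) ≡ suc (height k′ y)
      stable y⊏x = cong suc (height-stable _ (ℕ.<-≤-trans (#below-mono y⊏x) b≤k)
                                             (ℕ.<-≤-trans (#below-mono y⊏x) b≤k′))

  rank : Carrier S → ℕ
  rank x = height (suc (#below x)) x

  height-rank : ∀ {x y} → y ⊏ x → height (#below x) y ≡ rank y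
  height-rank y⊏x = height-stable _ (#below-mono y⊏x) ℕ.≤-refl

  rank-⊏ : ∀ {x y} → y ⊏ x → rank y <ℕ rank x
  rank-⊏ {x} {y} y⊏x = subst (λ r → suc r ≤ℕ rank x) (height-rank y⊏x)
    (All.lookup (xs≤max 0 _) (∈-map⁺ (suc ∘ height (#below x)) (∈-filter⁺ (_⊏? x) (∈-elements y) y⊏x)))

  rank-attained : ∀ x → 0 <ℕ rank x → Σ (Carrier S) λ y → y ⊏ x × rank x ≡ suc (rank y)
  rank-attained x 0<rank with argmax-sel (λ r → r) 0 (map (suc ∘ height (#below x)) (filter (_⊏? x) elements))
  ... | inj₁ rank≡0 = ⊥-elim (ℕ.<⇒≢ 0<rank (sym rank≡0))
  ... | inj₂ rank∈ with ∈-map⁻ (suc ∘ height (#below x)) rank∈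
  ...   | y , y∈ , rank≡ = y , y⊏x , trans rank≡ (cong suc (height-rank y⊏x))
    where
      y⊏x : y ⊏ x
      y⊏x = proj₂ (∈-filter⁻ (_⊏? x) {xs = elements} y∈)

  module _ (modular : Modular S lat) where

    lower-covers-meet : ∀ {x y w} → x ⋖ y → w ⋖ y → x ≢ w → (x ∧ w) ⋖ w × (x ∧ w) ⊏ x
    lower-covers-meet {x} {y} {w} x⋖y w⋖y x≢w = (k⊏w , k-cover) , k⊏x
      where
        k : Carrier S
        k = x ∧ w
        k⊏x : k ⊏ x
        k⊏x = x∧y≤x x w , λ k≡x →
          ⋖-incomparable x⋖y w⋖y x≢w (⊑-trans (⊑-reflexive (sym k≡x)) (x∧y≤y x w))
        k⊏w : k ⊏ w
        k⊏w = x∧y≤y x w , λ k≡w →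
          ⋖-incomparable w⋖y x⋖y (x≢w ∘ sym) (⊑-trans (⊑-reflexive (sym k≡w)) (x∧y≤x x w))
        k-cover : ∀ t → k ⊏ t → t ⊏ w → ⊥
        k-cover t (k⊑t , k≢t) (t⊑w , t≢w) = t≢w t≡w
          where
            open ≡-Reasoning
            t∨x≡y : t ∨ x ≡ y
            t∨x≡y with ⋖-between x⋖y (y≤x∨y t x) (∨-least (⊑-trans t⊑w (proj₁ (proj₁ w⋖y))) (proj₁ (proj₁ x⋖y)))
            ... | inj₂ t∨x≡y = t∨x≡y
            ... | inj₁ t∨x≡x = ⊥-elim (k≢t (⊑-antisym k⊑t
                    (∧-greatest (⊑-trans (x≤x∨y t x) (⊑-reflexive t∨x≡x)) t⊑w)))
            t≡w : t ≡ w
            t≡w = begin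
              t             ≡⟨ sym (x≤y⇒x∨y≈y k⊑t) ⟩
              k ∨ t         ≡⟨ ∨-comm k t ⟩
              t ∨ (x ∧ w)   ≡⟨ modular t x w t⊑w ⟩
              (t ∨ x) ∧ w   ≡⟨ cong (_∧ w) t∨x≡y ⟩
              y ∧ w         ≡⟨ y≤x⇒x∧y≈y (proj₁ (proj₁ w⋖y)) ⟩
              w             ∎

    rank-⋖ : ∀ n {x y} → rank y ≤ℕ n → x ⋖ y → rank y ≡ suc (rank x)
    rank-⋖ zero    rank≤0 x⋖y = ⊥-elim (ℕ.n≮0 (ℕ.≤-trans (rank-⊏ (proj₁ x⋖y)) rank≤0))
    rank-⋖ (suc n) {x} {y} rank≤n x⋖y with rank-attained y (ℕ.<-≤-trans (s≤s z≤n) (rank-⊏ (proj₁ x⋖y)))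
    ... | w , w⊏y , rank-y≡ with x ≟ w
    ...   | yes refl = rank-y≡
    ...   | no x≢w = ℕ.≤-antisym rank-y≤ (rank-⊏ (proj₁ x⋖y))
      where
        w⋖y : w ⋖ y
        w⋖y = w⊏y , λ t w⊏t t⊏y → ℕ.<-irrefl (sym rank-y≡)
          (ℕ.≤-trans (s≤s (rank-⊏ w⊏t)) (rank-⊏ t⊏y))
        meet : (x ∧ w) ⋖ w × (x ∧ w) ⊏ x
        meet = lower-covers-meet x⋖y w⋖y x≢w
        rank-w≡ : rank w ≡ suc (rank (x ∧ w))
        rank-w≡ = rank-⋖ n (ℕ.≤-pred (ℕ.≤-trans (ℕ.≤-reflexive (sym rank-y≡)) rank≤n)) (proj₁ meet)
        rank-y≤ : rank y ≤ℕ suc (rank x)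
        rank-y≤ = ℕ.≤-trans (ℕ.≤-reflexive (trans rank-y≡ (cong suc rank-w≡))) (s≤s (rank-⊏ (proj₂ meet)))

    graded : Graded S
    graded = rank , λ x y x⋖y → rank-⋖ (rank y) ℕ.≤-refl x⋖y

-- Vertical 2-sums

module VerticalTwoSum {L U : RelStr} (d : VSumData L U) where

  open VSumData d
  module L = FiniteLattice L-lat L-fin
  module U = FiniteLattice U-lat U-fin
  module U° = FiniteLattice U.dual U-fin
  open L using () renaming (_⊑_ to infix 4 _⊑L_; _∨_ to infixr 6 _∨L_; _∧_ to infixr 7 _∧L_)
  open U using () renaming (_⊑_ to infix 4 _⊑U_; _∨_ to infixr 6 _∨U_; _∧_ to infixr 7 _∧U_)

  c₁≢top : c₁ ≢ top
  c₁≢top = proj₂ (proj₁ c₁-coatom)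

  c₂≢top : c₂ ≢ top
  c₂≢top = proj₂ (proj₁ c₂-coatom)

  a₁≢bot : a₁ ≢ bot
  a₁≢bot = proj₂ (proj₁ a₁-atom) ∘ sym

  a₂≢bot : a₂ ≢ bot
  a₂≢bot = proj₂ (proj₁ a₂-atom) ∘ sym

  c₁⋢c₂ : ¬ c₁ ⊑L c₂
  c₁⋢c₂ = L.⋖-incomparable c₁-coatom c₂-coatom c₁≢c₂

  c₂⋢c₁ : ¬ c₂ ⊑L c₁
  c₂⋢c₁ = L.⋖-incomparable c₂-coatom c₁-coatom (c₁≢c₂ ∘ sym)

  a₁⋢a₂ : ¬ a₁ ⊑U a₂
  a₁⋢a₂ = U°.⋖-incomparable (⋖-dual {U} a₂-atom) (⋖-dual {U} a₁-atom) (a₁≢a₂ ∘ sym)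

  a₂⋢a₁ : ¬ a₂ ⊑U a₁
  a₂⋢a₁ = U°.⋖-incomparable (⋖-dual {U} a₁-atom) (⋖-dual {U} a₂-atom) a₁≢a₂

  top⋢c : ∀ {c} → c ≢ top → ¬ top ⊑L c
  top⋢c c≢top top⊑c = c≢top (L.⊑-antisym (top-max _) top⊑c)

  a⋢bot : ∀ {a} → a ≢ bot → ¬ a ⊑U bot
  a⋢bot a≢bot a⊑bot = a≢bot (U.⊑-antisym a⊑bot (bot-min _))

  below-c₁-or-c₂ : ∀ x → x ≢ top → x ⊑L c₁ ⊎ x ⊑L c₂
  below-c₁-or-c₂ x x≢top = below-coatom (L.coatom-above top-max x x≢top)
    where
      below-coatom : Σ (Carrier L) (λ c → x ⊑L c × _⋖ₛ_ L c top) → x ⊑L c₁ ⊎ x ⊑L c₂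
      below-coatom (c , x⊑c , c⋖top) =
        Sum.map (λ c≡c₁ → subst (x ⊑L_) c≡c₁ x⊑c) (λ c≡c₂ → subst (x ⊑L_) c≡c₂ x⊑c) (only-coatoms c c⋖top)

  above-a₁-or-a₂ : ∀ y → y ≢ bot → a₁ ⊑U y ⊎ a₂ ⊑U y
  above-a₁-or-a₂ y y≢bot = above-atom (U°.coatom-above bot-min y y≢bot)
    where
      above-atom : Σ (Carrier U) (λ a → a ⊑U y × _⋖ₛ_ (Dual U) a bot) → a₁ ⊑U y ⊎ a₂ ⊑U y
      above-atom (a , a⊑y , a⋖) =
        Sum.map (λ a≡a₁ → subst (_⊑U y) a≡a₁ a⊑y) (λ a≡a₂ → subst (_⊑U y) a≡a₂ a⊑y) (only-atoms a (⋖-dual {Dual U} a⋖))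

  coatom-maximal : ∀ {c t} → _⋖ₛ_ L c top → c ⊑L t → t ≢ top → t ≡ c
  coatom-maximal c⋖top c⊑t t≢top = [ (λ t≡c → t≡c) , (λ t≡top → ⊥-elim (t≢top t≡top)) ]′ (L.⋖-between c⋖top c⊑t (top-max _))

  atom-minimal : ∀ {a t} → _⋖ₛ_ U bot a → t ⊑U a → t ≢ bot → t ≡ a
  atom-minimal bot⋖a t⊑a t≢bot = [ (λ t≡a → t≡a) , (λ t≡bot → ⊥-elim (t≢bot t≡bot)) ]′ (U°.⋖-between (⋖-dual {U} bot⋖a) t⊑a (bot-min _))

  ∨-coatom : ∀ {c x} → _⋖ₛ_ L c top → ¬ x ⊑L c → x ∨L c ≡ top
  ∨-coatom c⋖top = L.⋖-∨ c⋖top (top-max _)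

  ∧-atom : ∀ {a y} → _⋖ₛ_ U bot a → ¬ a ⊑U y → y ∧U a ≡ bot
  ∧-atom bot⋖a = U°.⋖-∨ (⋖-dual {U} bot⋖a) (bot-min _)

  -- For x ≢ top and y ≢ bot, x ≲ y says exactly that low x ≼ high y in the sum.
  _≲_ : Carrier L → Carrier U → Set
  x ≲ y = (x ⊑L c₂ ⊎ a₁ ⊑U y) × (x ⊑L c₁ ⊎ a₂ ⊑U y)

  φ : Carrier L → Carrier U
  φ x with x L.⊑? c₁ | x L.⊑? c₂
  ... | yes _ | yes _ = bot
  ... | yes _ | no _  = a₁
  ... | no _  | yes _ = a₂
  ... | no _  | no _  = a₁ ∨U a₂

  ψ : Carrier U → Carrier L
  ψ y with a₁ U.⊑? y | a₂ U.⊑? y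
  ... | yes _ | yes _ = top
  ... | yes _ | no _  = c₁
  ... | no _  | yes _ = c₂
  ... | no _  | no _  = c₁ ∧L c₂

  φ⊑⇒≲ : ∀ {x y} → φ x ⊑U y → x ≲ y
  φ⊑⇒≲ {x} φx⊑y with x L.⊑? c₁ | x L.⊑? c₂
  ... | yes x⊑c₁ | yes x⊑c₂ = inj₁ x⊑c₂ , inj₁ x⊑c₁
  ... | yes x⊑c₁ | no _     = inj₂ φx⊑y , inj₁ x⊑c₁
  ... | no _     | yes x⊑c₂ = inj₁ x⊑c₂ , inj₂ φx⊑y
  ... | no _     | no _     = inj₂ (U.⊑-trans (U.x≤x∨y a₁ a₂) φx⊑y) , inj₂ (U.⊑-trans (U.y≤x∨y a₁ a₂) φx⊑y)

  ≲⇒φ⊑ : ∀ {x y} → x ≲ y → φ x ⊑U y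
  ≲⇒φ⊑ {x} (c₂-or-a₁ , c₁-or-a₂) with x L.⊑? c₁ | x L.⊑? c₂ | c₂-or-a₁ | c₁-or-a₂
  ... | yes _    | yes _    | _           | _           = bot-min _
  ... | yes _    | no x⋢c₂  | inj₁ x⊑c₂   | _           = ⊥-elim (x⋢c₂ x⊑c₂)
  ... | yes _    | no _     | inj₂ a₁⊑y   | _           = a₁⊑y
  ... | no x⋢c₁  | yes _    | _           | inj₁ x⊑c₁   = ⊥-elim (x⋢c₁ x⊑c₁)
  ... | no _     | yes _    | _           | inj₂ a₂⊑y   = a₂⊑y
  ... | no _     | no x⋢c₂  | inj₁ x⊑c₂   | _           = ⊥-elim (x⋢c₂ x⊑c₂)
  ... | no x⋢c₁  | no _     | inj₂ _      | inj₁ x⊑c₁   = ⊥-elim (x⋢c₁ x⊑c₁)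
  ... | no _     | no _     | inj₂ a₁⊑y   | inj₂ a₂⊑y   = U.∨-least a₁⊑y a₂⊑y

  ⊑ψ⇒≲ : ∀ {x y} → x ⊑L ψ y → x ≲ y
  ⊑ψ⇒≲ {y = y} x⊑ψy with a₁ U.⊑? y | a₂ U.⊑? y
  ... | yes a₁⊑y | yes a₂⊑y = inj₂ a₁⊑y , inj₂ a₂⊑y
  ... | yes a₁⊑y | no _     = inj₂ a₁⊑y , inj₁ x⊑ψy
  ... | no _     | yes a₂⊑y = inj₁ x⊑ψy , inj₂ a₂⊑y
  ... | no _     | no _     = inj₁ (L.⊑-trans x⊑ψy (L.x∧y≤y c₁ c₂)) , inj₁ (L.⊑-trans x⊑ψy (L.x∧y≤x c₁ c₂))

  ≲⇒⊑ψ : ∀ {x y} → x ≲ y → x ⊑L ψ y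
  ≲⇒⊑ψ {y = y} (c₂-or-a₁ , c₁-or-a₂) with a₁ U.⊑? y | a₂ U.⊑? y | c₂-or-a₁ | c₁-or-a₂
  ... | yes _    | yes _    | _         | _         = top-max _
  ... | yes _    | no a₂⋢y  | _         | inj₂ a₂⊑y = ⊥-elim (a₂⋢y a₂⊑y)
  ... | yes _    | no _     | _         | inj₁ x⊑c₁ = x⊑c₁
  ... | no a₁⋢y  | yes _    | inj₂ a₁⊑y | _         = ⊥-elim (a₁⋢y a₁⊑y)
  ... | no _     | yes _    | inj₁ x⊑c₂ | _         = x⊑c₂
  ... | no a₁⋢y  | no _     | inj₂ a₁⊑y | _         = ⊥-elim (a₁⋢y a₁⊑y)
  ... | no _     | no a₂⋢y  | inj₁ _    | inj₂ a₂⊑y = ⊥-elim (a₂⋢y a₂⊑y)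
  ... | no _     | no _     | inj₁ x⊑c₂ | inj₁ x⊑c₁ = L.∧-greatest x⊑c₁ x⊑c₂

  φ⊑⇒⊑ψ : ∀ {x y} → φ x ⊑U y → x ⊑L ψ y
  φ⊑⇒⊑ψ φx⊑y = ≲⇒⊑ψ (φ⊑⇒≲ φx⊑y)

  ⊑ψ⇒φ⊑ : ∀ {x y} → x ⊑L ψ y → φ x ⊑U y
  ⊑ψ⇒φ⊑ x⊑ψy = ≲⇒φ⊑ (⊑ψ⇒≲ x⊑ψy)

  ≲-monoʳ : ∀ {x y y′} → y ⊑U y′ → x ≲ y → x ≲ y′
  ≲-monoʳ y⊑y′ (p , q) = Sum.map₂ (λ a⊑y → U.⊑-trans a⊑y y⊑y′) p , Sum.map₂ (λ a⊑y → U.⊑-trans a⊑y y⊑y′) q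

  ≲-monoˡ : ∀ {x x′ y} → x ⊑L x′ → x′ ≲ y → x ≲ y
  ≲-monoˡ x⊑x′ (p , q) = Sum.map₁ (L.⊑-trans x⊑x′) p , Sum.map₁ (L.⊑-trans x⊑x′) q

  ≲-∧ : ∀ {x y y′} → x ≲ y → x ≲ y′ → x ≲ (y ∧U y′)
  ≲-∧ (p , q) (p′ , q′) = meet p p′ , meet q q′
    where
      meet : ∀ {P : Set} {a y y′} → P ⊎ a ⊑U y → P ⊎ a ⊑U y′ → P ⊎ a ⊑U (y ∧U y′)
      meet (inj₁ p) _          = inj₁ p
      meet (inj₂ _) (inj₁ p)   = inj₁ p
      meet (inj₂ a⊑y) (inj₂ a⊑y′) = inj₂ (U.∧-greatest a⊑y a⊑y′)

  ψ-mono : ∀ {y y′} → y ⊑U y′ → ψ y ⊑L ψ y′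
  ψ-mono y⊑y′ = ≲⇒⊑ψ (≲-monoʳ y⊑y′ (⊑ψ⇒≲ L.⊑-refl))

  φ-mono : ∀ {x x′} → x ⊑L x′ → φ x ⊑U φ x′
  φ-mono x⊑x′ = ≲⇒φ⊑ (≲-monoˡ x⊑x′ (φ⊑⇒≲ U.⊑-refl))

  ⊑ψφ : ∀ x → x ⊑L ψ (φ x)
  ⊑ψφ x = φ⊑⇒⊑ψ U.⊑-refl

  ψ-∧ : ∀ y y′ → ψ (y ∧U y′) ≡ ψ y ∧L ψ y′
  ψ-∧ y y′ = L.⊑-antisym
    (L.∧-greatest (ψ-mono (U.x∧y≤x y y′)) (ψ-mono (U.x∧y≤y y y′)))
    (≲⇒⊑ψ (≲-∧ (⊑ψ⇒≲ (L.x∧y≤x _ _)) (⊑ψ⇒≲ (L.x∧y≤y _ _))))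

  ψ≡top : ∀ {y} → ψ y ≡ top → a₁ ⊑U y × a₂ ⊑U y
  ψ≡top {y} ψy≡top with ⊑ψ⇒≲ {y = y} (L.⊑-reflexive (sym ψy≡top))
  ... | inj₁ top⊑c₂ , _ = ⊥-elim (top⋢c c₂≢top top⊑c₂)
  ... | _ , inj₁ top⊑c₁ = ⊥-elim (top⋢c c₁≢top top⊑c₁)
  ... | inj₂ a₁⊑y , inj₂ a₂⊑y = a₁⊑y , a₂⊑y

  ψ-top : ∀ {y} → a₁ ⊑U y → a₂ ⊑U y → ψ y ≡ top
  ψ-top a₁⊑y a₂⊑y = L.⊑-antisym (top-max _) (≲⇒⊑ψ (inj₂ a₁⊑y , inj₂ a₂⊑y))

  ψ-c₁ : ∀ {y} → a₁ ⊑U y → ¬ a₂ ⊑U y → ψ y ≡ c₁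
  ψ-c₁ {y} a₁⊑y a₂⋢y with a₁ U.⊑? y | a₂ U.⊑? y
  ... | yes _     | yes a₂⊑y = ⊥-elim (a₂⋢y a₂⊑y)
  ... | yes _     | no _     = refl
  ... | no a₁⋢y   | _        = ⊥-elim (a₁⋢y a₁⊑y)

  ψ-c₂ : ∀ {y} → ¬ a₁ ⊑U y → a₂ ⊑U y → ψ y ≡ c₂
  ψ-c₂ {y} a₁⋢y a₂⊑y with a₁ U.⊑? y | a₂ U.⊑? y
  ... | yes a₁⊑y  | _        = ⊥-elim (a₁⋢y a₁⊑y)
  ... | no _      | yes _    = refl
  ... | no _      | no a₂⋢y  = ⊥-elim (a₂⋢y a₂⊑y)

  ψ-bot : ψ bot ≡ c₁ ∧L c₂
  ψ-bot with a₁ U.⊑? bot | a₂ U.⊑? bot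
  ... | yes a₁⊑bot | _          = ⊥-elim (a⋢bot a₁≢bot a₁⊑bot)
  ... | no _       | yes a₂⊑bot = ⊥-elim (a⋢bot a₂≢bot a₂⊑bot)
  ... | no _       | no _       = refl

  φ-a₁ : ∀ {x} → x ⊑L c₁ → ¬ x ⊑L c₂ → φ x ≡ a₁
  φ-a₁ {x} x⊑c₁ x⋢c₂ with x L.⊑? c₁ | x L.⊑? c₂
  ... | yes _     | yes x⊑c₂ = ⊥-elim (x⋢c₂ x⊑c₂)
  ... | yes _     | no _     = refl
  ... | no x⋢c₁   | _        = ⊥-elim (x⋢c₁ x⊑c₁)

  φ-a₂ : ∀ {x} → ¬ x ⊑L c₁ → x ⊑L c₂ → φ x ≡ a₂
  φ-a₂ {x} x⋢c₁ x⊑c₂ with x L.⊑? c₁ | x L.⊑? c₂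
  ... | yes x⊑c₁  | _        = ⊥-elim (x⋢c₁ x⊑c₁)
  ... | no _      | yes _    = refl
  ... | no _      | no x⋢c₂  = ⊥-elim (x⋢c₂ x⊑c₂)

  φ-bot : ∀ {x} → x ⊑L c₁ → x ⊑L c₂ → φ x ≡ bot
  φ-bot x⊑c₁ x⊑c₂ = U.⊑-antisym (≲⇒φ⊑ (inj₁ x⊑c₂ , inj₁ x⊑c₁)) (bot-min _)

  φ⊑a₁∨a₂ : ∀ x → φ x ⊑U (a₁ ∨U a₂)
  φ⊑a₁∨a₂ x = ≲⇒φ⊑ (inj₂ (U.x≤x∨y a₁ a₂) , inj₂ (U.y≤x∨y a₁ a₂))

  V : Set
  V = VCar d

  _≼_ : V → V → Set
  _≼_ = _≼ᵈ_ d

  Upper : Carrier U → Set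
  Upper y = y ≢ bot × y ≢ a₁ × y ≢ a₂

  high′ : ∀ y → .(Upper y) → V
  high′ y u = high y (proj₁ u) (proj₁ (proj₂ u)) (proj₂ (proj₂ u))

  upper? : ∀ y → Dec (Upper y)
  upper? y = ¬? (y U.≟ bot) ×-dec ¬? (y U.≟ a₁) ×-dec ¬? (y U.≟ a₂)

  not-upper : ∀ {y} → ¬ Upper y → y ≡ bot ⊎ y ≡ a₁ ⊎ y ≡ a₂
  not-upper {y} ¬upper with y U.≟ bot | y U.≟ a₁ | y U.≟ a₂
  ... | yes y≡bot | _        | _        = inj₁ y≡bot
  ... | no _      | yes y≡a₁ | _        = inj₂ (inj₁ y≡a₁)
  ... | no _      | no _     | yes y≡a₂ = inj₂ (inj₂ y≡a₂)
  ... | no y≢bot  | no y≢a₁  | no y≢a₂  = ⊥-elim (¬upper (y≢bot , y≢a₁ , y≢a₂))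

  recompute-upper : ∀ {y} → .(Upper y) → Upper y
  recompute-upper u = ¬-recompute (proj₁ u) , ¬-recompute (proj₁ (proj₂ u)) , ¬-recompute (proj₂ (proj₂ u))

  upper-up : ∀ {y z} → Upper y → y ⊑U z → Upper z
  upper-up {y} (y≢bot , y≢a₁ , y≢a₂) y⊑z =
    (λ { refl → y≢bot (U.⊑-antisym y⊑z (bot-min y)) }) ,
    (λ { refl → y≢a₁ (atom-minimal a₁-atom y⊑z y≢bot) }) ,
    (λ { refl → y≢a₂ (atom-minimal a₂-atom y⊑z y≢bot) })

  upper-a₁∨a₂ : Upper (a₁ ∨U a₂)
  upper-a₁∨a₂ =
    (λ e → a⋢bot a₁≢bot (subst (a₁ ⊑U_) e (U.x≤x∨y a₁ a₂))) ,
    (λ e → a₂⋢a₁ (subst (a₂ ⊑U_) e (U.y≤x∨y a₁ a₂))) ,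
    (λ e → a₁⋢a₂ (subst (a₁ ⊑U_) e (U.x≤x∨y a₁ a₂)))

  upper-above-atoms : ∀ {y} → a₁ ⊑U y → a₂ ⊑U y → Upper y
  upper-above-atoms a₁⊑y a₂⊑y = upper-up upper-a₁∨a₂ (U.∨-least a₁⊑y a₂⊑y)

  ψ≢top : ∀ {y} → ¬ Upper y → ψ y ≢ top
  ψ≢top ¬upper ψy≡top = ¬upper (upper-above-atoms (proj₁ (ψ≡top ψy≡top)) (proj₂ (ψ≡top ψy≡top)))

  ≢top-down : ∀ {x x′} → x′ ⊑L x → x ≢ top → x′ ≢ top
  ≢top-down x′⊑x x≢top refl = x≢top (L.⊑-antisym (top-max _) x′⊑x)

  projL : V → Carrier L
  projL (low x _)      = x
  projL (high y _ _ _) = ψ y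

  projU : V → Carrier U
  projU (low x _)      = φ x
  projU (high y _ _ _) = y

  -- The top of L becomes c₁ ∨ c₂ = a₁ ∨ a₂; bot, a₁, a₂ of U become c₁ ∧ c₂, c₁, c₂.
  embedL : Carrier L → V
  embedL x with x L.≟ top
  ... | yes _    = high′ (a₁ ∨U a₂) upper-a₁∨a₂
  ... | no x≢top = low x x≢top

  embedU : Carrier U → V
  embedU y with upper? y
  ... | yes upper  = high′ y upper
  ... | no ¬upper = low (ψ y) (ψ≢top ¬upper)

  low-≼⁻ : ∀ {x} .{x≢top} w → low x x≢top ≼ w → x ⊑L projL w
  low-≼⁻ (low _ _)      (ll x⊑x′)       = x⊑x′
  low-≼⁻ (high _ _ _ _) (lh₁ x⊑c₁ a₁⊑y) = ≲⇒⊑ψ (inj₂ a₁⊑y , inj₁ x⊑c₁)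
  low-≼⁻ (high _ _ _ _) (lh₂ x⊑c₂ a₂⊑y) = ≲⇒⊑ψ (inj₁ x⊑c₂ , inj₂ a₂⊑y)

  low-≼⁺ : ∀ {x} .{x≢top} w → x ⊑L projL w → low x x≢top ≼ w
  low-≼⁺ (low _ _) x⊑x′ = ll x⊑x′
  low-≼⁺ {x} {x≢top} (high y y≢bot _ _) x⊑ψy with ⊑ψ⇒≲ x⊑ψy
  ... | inj₂ a₁⊑y , inj₁ x⊑c₁ = lh₁ x⊑c₁ a₁⊑y
  ... | inj₁ x⊑c₂ , inj₂ a₂⊑y = lh₂ x⊑c₂ a₂⊑y
  ... | inj₁ x⊑c₂ , inj₁ x⊑c₁ =
    [ (λ a₁⊑y → lh₁ x⊑c₁ a₁⊑y) , (λ a₂⊑y → lh₂ x⊑c₂ a₂⊑y) ]′ (above-a₁-or-a₂ y (¬-recompute y≢bot))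
  ... | inj₂ a₁⊑y , inj₂ a₂⊑y =
    [ (λ x⊑c₁ → lh₁ x⊑c₁ a₁⊑y) , (λ x⊑c₂ → lh₂ x⊑c₂ a₂⊑y) ]′ (below-c₁-or-c₂ x (¬-recompute x≢top))

  high-≼⁻ : ∀ {y} .{p q r} w → high y p q r ≼ w → y ⊑U projU w
  high-≼⁻ (high _ _ _ _) (hh y⊑y′) = y⊑y′

  high-≼⁺ : ∀ {y} .{p q r} w → y ⊑U projU w → high y p q r ≼ w
  high-≼⁺ (high _ _ _ _) y⊑y′ = hh y⊑y′
  high-≼⁺ {y} {y≢bot} {y≢a₁} {y≢a₂} (low x x≢top) y⊑φx =
    ⊥-elim ([ below-c₁ , below-c₂ ]′ (below-c₁-or-c₂ x (¬-recompute x≢top)))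
    where
      below-c₁ : x ⊑L c₁ → ⊥
      below-c₁ x⊑c₁ = ¬-recompute y≢a₁ (atom-minimal a₁-atom
        (U.⊑-trans y⊑φx (≲⇒φ⊑ (inj₂ U.⊑-refl , inj₁ x⊑c₁))) (¬-recompute y≢bot))
      below-c₂ : x ⊑L c₂ → ⊥
      below-c₂ x⊑c₂ = ¬-recompute y≢a₂ (atom-minimal a₂-atom
        (U.⊑-trans y⊑φx (≲⇒φ⊑ (inj₁ x⊑c₂ , inj₂ U.⊑-refl))) (¬-recompute y≢bot))

  ≼-high⁻ : ∀ v {y} .{p q r} → v ≼ high y p q r → projU v ⊑U y
  ≼-high⁻ (low x _)      v≼w    = ⊑ψ⇒φ⊑ (low-≼⁻ _ v≼w)
  ≼-high⁻ (high _ _ _ _) (hh y⊑y′) = y⊑y′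

  ≼-high⁺ : ∀ v {y} .{p q r} → projU v ⊑U y → v ≼ high y p q r
  ≼-high⁺ (low x _)      φx⊑y  = low-≼⁺ _ (φ⊑⇒⊑ψ φx⊑y)
  ≼-high⁺ (high _ _ _ _) y⊑y′ = hh y⊑y′

  projL-mono : ∀ {v w} → v ≼ w → projL v ⊑L projL w
  projL-mono (ll x⊑x′)     = x⊑x′
  projL-mono (hh y⊑y′)     = ψ-mono y⊑y′
  projL-mono v≼w@(lh₁ _ _) = low-≼⁻ _ v≼w
  projL-mono v≼w@(lh₂ _ _) = low-≼⁻ _ v≼w

  projU-mono : ∀ {v w} → v ≼ w → projU v ⊑U projU w
  projU-mono (ll x⊑x′)     = φ-mono x⊑x′
  projU-mono (hh y⊑y′)     = y⊑y′
  projU-mono v≼w@(lh₁ _ _) = ≼-high⁻ _ v≼w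
  projU-mono v≼w@(lh₂ _ _) = ≼-high⁻ _ v≼w

  ≼-refl : ∀ {v} → v ≼ v
  ≼-refl {low _ _}      = ll L.⊑-refl
  ≼-refl {high _ _ _ _} = hh U.⊑-refl

  ≼-trans : ∀ {u v w} → u ≼ v → v ≼ w → u ≼ w
  ≼-trans {low _ _}      {v} {w} u≼v v≼w = low-≼⁺ w (L.⊑-trans (low-≼⁻ v u≼v) (projL-mono v≼w))
  ≼-trans {high _ _ _ _} {v} {w} u≼v v≼w = high-≼⁺ w (U.⊑-trans (high-≼⁻ v u≼v) (projU-mono v≼w))

  low-cong : ∀ {x x′} .{p p′} → x ≡ x′ → low {d = d} x p ≡ low x′ p′
  low-cong refl = refl

  high-cong : ∀ {y y′} .{p q r p′ q′ r′} → y ≡ y′ → high {d = d} y p q r ≡ high y′ p′ q′ r′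
  high-cong refl = refl

  ≼-antisym : ∀ {v w} → v ≼ w → w ≼ v → v ≡ w
  ≼-antisym (ll x⊑x′) (ll x′⊑x) = low-cong (L.⊑-antisym x⊑x′ x′⊑x)
  ≼-antisym (hh y⊑y′) (hh y′⊑y) = high-cong (U.⊑-antisym y⊑y′ y′⊑y)

  projL-embedL : ∀ x → projL (embedL x) ≡ x
  projL-embedL x with x L.≟ top
  ... | yes x≡top = trans (ψ-top (U.x≤x∨y a₁ a₂) (U.y≤x∨y a₁ a₂)) (sym x≡top)
  ... | no _      = refl

  embedL-low : ∀ x (x≢top : x ≢ top) → embedL x ≡ low x x≢top
  embedL-low x x≢top with x L.≟ top
  ... | yes x≡top = ⊥-elim (x≢top x≡top)
  ... | no _      = refl

  embedL-top : embedL top ≡ high′ (a₁ ∨U a₂) upper-a₁∨a₂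
  embedL-top with top L.≟ top
  ... | yes _        = refl
  ... | no top≢top = ⊥-elim (top≢top refl)

  embedL-≼ : ∀ x w → x ⊑L projL w → embedL x ≼ w
  embedL-≼ x w x⊑w with x L.≟ top
  embedL-≼ x (low x′ x′≢top) x⊑x′ | yes refl = ⊥-elim (¬-recompute x′≢top (L.⊑-antisym (top-max x′) x⊑x′))
  embedL-≼ x (high y _ _ _)  x⊑ψy | yes refl =
    hh (U.∨-least (proj₁ (ψ≡top ψy≡top)) (proj₂ (ψ≡top ψy≡top)))
    where
      ψy≡top : ψ y ≡ top
      ψy≡top = L.⊑-antisym (top-max _) x⊑ψy
  embedL-≼ x w x⊑w | no _ = low-≼⁺ w x⊑w

  ≼-embedL : ∀ x w → embedL x ≼ w → x ⊑L projL w
  ≼-embedL x w x≼w = subst (_⊑L projL w) (projL-embedL x) (projL-mono x≼w)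

  projL-embedU : ∀ y → projL (embedU y) ≡ ψ y
  projL-embedU y with upper? y
  ... | yes _ = refl
  ... | no _  = refl

  φψ-non-upper : ∀ {y} → ¬ Upper y → φ (ψ y) ≡ y
  φψ-non-upper ¬upper with not-upper ¬upper
  ... | inj₁ refl        = trans (cong φ ψ-bot) (φ-bot (L.x∧y≤x c₁ c₂) (L.x∧y≤y c₁ c₂))
  ... | inj₂ (inj₁ refl) = trans (cong φ (ψ-c₁ U.⊑-refl a₂⋢a₁)) (φ-a₁ L.⊑-refl c₁⋢c₂)
  ... | inj₂ (inj₂ refl) = trans (cong φ (ψ-c₂ a₁⋢a₂ U.⊑-refl)) (φ-a₂ c₂⋢c₁ L.⊑-refl)

  projU-embedU : ∀ y → projU (embedU y) ≡ y
  projU-embedU y with upper? y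
  ... | yes _      = refl
  ... | no ¬upper = φψ-non-upper ¬upper

  embedU-upper : ∀ y (upper : Upper y) → embedU y ≡ high′ y upper
  embedU-upper y upper with upper? y
  ... | yes _      = refl
  ... | no ¬upper = ⊥-elim (¬upper upper)

  embedU-non-upper : ∀ y (¬upper : ¬ Upper y) → embedU y ≡ low (ψ y) (ψ≢top ¬upper)
  embedU-non-upper y ¬upper with upper? y
  ... | yes upper = ⊥-elim (¬upper upper)
  ... | no _      = refl

  embedL-ψ-non-upper : ∀ {y} → ¬ Upper y → embedL (ψ y) ≡ embedU y
  embedL-ψ-non-upper {y} ¬upper = trans (embedL-low (ψ y) (ψ≢top ¬upper)) (sym (embedU-non-upper y ¬upper))

  embedU-≼ : ∀ y {y′} .{p q r} → y ⊑U y′ → embedU y ≼ high y′ p q r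
  embedU-≼ y y⊑y′ with upper? y
  ... | yes _ = hh y⊑y′
  ... | no _  = low-≼⁺ _ (ψ-mono y⊑y′)

  ≼-embedU : ∀ y {y′} .{p q r} → y′ ⊑U y → high y′ p q r ≼ embedU y
  ≼-embedU y {y′} {p} {q} {r} y′⊑y with upper? y
  ... | yes _      = hh y′⊑y
  ... | no ¬upper = ⊥-elim (¬upper (upper-up (recompute-upper (p , q , r)) y′⊑y))

  _⊔_ : V → V → V
  low x _ ⊔ low x′ _            = embedL (x ∨L x′)
  v@(low _ _) ⊔ w@(high _ p q r) = high′ (projU v ∨U projU w) (upper-up (p , q , r) (U.y≤x∨y _ _))
  v@(high _ p q r) ⊔ w          = high′ (projU v ∨U projU w) (upper-up (p , q , r) (U.x≤x∨y _ _))

  _⊓_ : V → V → V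
  low x x≢top ⊓ w                = low (x ∧L projL w) (≢top-down (L.x∧y≤x _ _) x≢top)
  v@(high _ _ _ _) ⊓ low x x≢top = low (projL v ∧L x) (≢top-down (L.x∧y≤y _ _) x≢top)
  high y _ _ _ ⊓ high y′ _ _ _   = embedU (y ∧U y′)

  ⊔-upperˡ : ∀ v w → v ≼ (v ⊔ w)
  ⊔-upperˡ (low x _)      (low x′ _)     = low-≼⁺ _ (subst (x ⊑L_) (sym (projL-embedL _)) (L.x≤x∨y x x′))
  ⊔-upperˡ v@(low _ _)    (high _ _ _ _) = ≼-high⁺ v (U.x≤x∨y _ _)
  ⊔-upperˡ v@(high _ _ _ _) _            = ≼-high⁺ v (U.x≤x∨y _ _)

  ⊔-upperʳ : ∀ v w → w ≼ (v ⊔ w)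
  ⊔-upperʳ (low x _)        (low x′ _)       = low-≼⁺ _ (subst (x′ ⊑L_) (sym (projL-embedL _)) (L.y≤x∨y x x′))
  ⊔-upperʳ (low _ _)        w@(high _ _ _ _) = ≼-high⁺ w (U.y≤x∨y _ _)
  ⊔-upperʳ (high _ _ _ _)   w                = ≼-high⁺ w (U.y≤x∨y _ _)

  ⊔-least : ∀ v w u → v ≼ u → w ≼ u → (v ⊔ w) ≼ u
  ⊔-least (low x _)      (low x′ _)     u v≼u w≼u = embedL-≼ _ u (L.∨-least (low-≼⁻ u v≼u) (low-≼⁻ u w≼u))
  ⊔-least (low _ _)      (high _ _ _ _) u v≼u w≼u = high-≼⁺ u (U.∨-least (projU-mono v≼u) (projU-mono w≼u))
  ⊔-least (high _ _ _ _) _              u v≼u w≼u = high-≼⁺ u (U.∨-least (projU-mono v≼u) (projU-mono w≼u))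

  ⊓-lowerˡ : ∀ v w → (v ⊓ w) ≼ v
  ⊓-lowerˡ v@(low x _)          w            = low-≼⁺ v (L.x∧y≤x x (projL w))
  ⊓-lowerˡ v@(high _ _ _ _)     (low x _)    = low-≼⁺ v (L.x∧y≤x (projL v) x)
  ⊓-lowerˡ (high y _ _ _) (high y′ _ _ _)    = embedU-≼ (y ∧U y′) (U.x∧y≤x y y′)

  ⊓-lowerʳ : ∀ v w → (v ⊓ w) ≼ w
  ⊓-lowerʳ (low x _)          w              = low-≼⁺ w (L.x∧y≤y x (projL w))
  ⊓-lowerʳ v@(high _ _ _ _)   w@(low x _)    = low-≼⁺ w (L.x∧y≤y (projL v) x)
  ⊓-lowerʳ (high y _ _ _) (high y′ _ _ _)    = embedU-≼ (y ∧U y′) (U.x∧y≤y y y′)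

  ⊓-greatest : ∀ v w u → u ≼ v → u ≼ w → u ≼ (v ⊓ w)
  ⊓-greatest v@(low _ _)        w          (low _ _) u≼v u≼w =
    low-≼⁺ (v ⊓ w) (L.∧-greatest (low-≼⁻ v u≼v) (low-≼⁻ w u≼w))
  ⊓-greatest v@(high _ _ _ _) w@(low _ _)  (low _ _) u≼v u≼w =
    low-≼⁺ (v ⊓ w) (L.∧-greatest (low-≼⁻ v u≼v) (low-≼⁻ w u≼w))
  ⊓-greatest v@(high y _ _ _) w@(high y′ _ _ _) (low s _) u≼v u≼w =
    low-≼⁺ (v ⊓ w) (subst (s ⊑L_) (sym (trans (projL-embedU (y ∧U y′)) (ψ-∧ y y′)))
                      (L.∧-greatest (low-≼⁻ v u≼v) (low-≼⁻ w u≼w)))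
  ⊓-greatest (high y _ _ _) (high y′ _ _ _) (high _ _ _ _) (hh u⊑y) (hh u⊑y′) =
    ≼-embedU (y ∧U y′) (U.∧-greatest u⊑y u⊑y′)

  sum-lattice : IsLatticeStr (VSum d)
  sum-lattice = record
    { _∨_ = _⊔_
    ; _∧_ = _⊓_
    ; isLattice = record
      { isPartialOrder = record
        { isPreorder = record
          { isEquivalence = isEquivalence
          ; reflexive     = λ { refl → ≼-refl }
          ; trans         = ≼-trans
          }
        ; antisym = ≼-antisym
        }
      ; supremum = λ v w → ⊔-upperˡ v w , ⊔-upperʳ v w , λ u → ⊔-least v w u
      ; infimum  = λ v w → ⊓-lowerˡ v w , ⊓-lowerʳ v w , λ u → ⊓-greatest v w u
      }
    }

  ⊓-lowʳ : ∀ v z (z≢top : z ≢ top) → v ⊓ low z z≢top ≡ embedL (projL v ∧L z)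
  ⊓-lowʳ (low x x≢top)  z _     = sym (embedL-low _ (≢top-down (L.x∧y≤x _ _) (¬-recompute x≢top)))
  ⊓-lowʳ (high _ _ _ _) z z≢top = sym (embedL-low _ (≢top-down (L.x∧y≤y _ _) z≢top))

  ⊓-lowˡ : ∀ x (x≢top : x ≢ top) w → low x x≢top ⊓ w ≡ embedL (x ∧L projL w)
  ⊓-lowˡ x x≢top w = sym (embedL-low _ (≢top-down (L.x∧y≤x _ _) x≢top))

  ⊔-highˡ : ∀ y .(upper : Upper y) v → high′ y upper ⊔ v ≡ embedU (y ∨U projU v)
  ⊔-highˡ y upper v = sym (embedU-upper _ (upper-up (recompute-upper upper) (U.x≤x∨y _ _)))

  ⊔-highʳ : ∀ v y .{p q r} → v ⊔ high y p q r ≡ embedU (projU v ∨U y)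
  ⊔-highʳ (low _ _)      y {p} {q} {r} = sym (embedU-upper _ (upper-up (recompute-upper (p , q , r)) (U.y≤x∨y _ _)))
  ⊔-highʳ (high _ p q r) y = sym (embedU-upper _ (upper-up (recompute-upper (p , q , r)) (U.x≤x∨y _ _)))

  non-upper⊑a₁∨a₂ : ∀ {y} → ¬ Upper y → y ⊑U (a₁ ∨U a₂)
  non-upper⊑a₁∨a₂ ¬upper with not-upper ¬upper
  ... | inj₁ refl        = bot-min _
  ... | inj₂ (inj₁ refl) = U.x≤x∨y _ _
  ... | inj₂ (inj₂ refl) = U.y≤x∨y _ _

  ∨-bot : ∀ y → y ∨U bot ≡ y
  ∨-bot y = trans (U.∨-comm y bot) (U.x≤y⇒x∨y≈y (bot-min y))

  bot-without-atoms : ∀ {y} → ¬ a₁ ⊑U y → ¬ a₂ ⊑U y → y ≡ bot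
  bot-without-atoms {y} a₁⋢y a₂⋢y with y U.≟ bot
  ... | yes y≡bot = y≡bot
  ... | no y≢bot  = ⊥-elim ([ a₁⋢y , a₂⋢y ]′ (above-a₁-or-a₂ y y≢bot))

  module _ (modularL : Modular L L-lat) (modularU : Modular U U-lat) where

    ∨-meet-coatoms : ∀ {x c c′} → _⋖ₛ_ L c′ top → x ⊑L c → ¬ x ⊑L c′ → x ∨L (c′ ∧L c) ≡ c
    ∨-meet-coatoms {x} {c} {c′} c′⋖top x⊑c x⋢c′ = begin
      x ∨L (c′ ∧L c)   ≡⟨ modularL x c′ c x⊑c ⟩
      (x ∨L c′) ∧L c   ≡⟨ cong (_∧L c) (∨-coatom c′⋖top x⋢c′) ⟩
      top ∧L c         ≡⟨ L.y≤x⇒x∧y≈y (top-max c) ⟩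
      c                ∎
      where open ≡-Reasoning

    between-atoms : ∀ {y a b} → _⋖ₛ_ U bot b → a ⊑U y → y ⊑U (a ∨U b) → ¬ b ⊑U y → y ≡ a
    between-atoms {y} {a} {b} bot⋖b a⊑y y⊑a∨b b⋢y = begin
      y                ≡⟨ sym (U.y≤x⇒x∧y≈y y⊑a∨b) ⟩
      (a ∨U b) ∧U y    ≡⟨ sym (modularU a b y a⊑y) ⟩
      a ∨U (b ∧U y)    ≡⟨ cong (a ∨U_) (trans (U.∧-comm b y) (∧-atom bot⋖b b⋢y)) ⟩
      a ∨U bot         ≡⟨ trans (U.∨-comm a bot) (U.x≤y⇒x∨y≈y (bot-min a)) ⟩
      a                ∎
      where open ≡-Reasoning

    ψ-∨-≲ : ∀ {x y} → x ≲ y → ψ (φ x ∨U y) ⊑L (x ∨L ψ y)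
    ψ-∨-≲ x≲y = L.⊑-trans (ψ-mono (U.∨-least (≲⇒φ⊑ x≲y) U.⊑-refl)) (L.y≤x∨y _ _)

    ψ-∨-top : ∀ {x y} → x ∨L ψ y ≡ top → ψ (φ x ∨U y) ⊑L (x ∨L ψ y)
    ψ-∨-top x∨ψy≡top = L.⊑-trans (top-max _) (L.⊑-reflexive (sym x∨ψy≡top))

    ψ-∨-bot₁ : ∀ {x} → x ⊑L c₁ → ¬ x ⊑L c₂ → ψ (φ x ∨U bot) ≡ x ∨L ψ bot
    ψ-∨-bot₁ {x} x⊑c₁ x⋢c₂ = begin
      ψ (φ x ∨U bot)   ≡⟨ cong ψ (trans (∨-bot (φ x)) (φ-a₁ x⊑c₁ x⋢c₂)) ⟩
      ψ a₁             ≡⟨ ψ-c₁ U.⊑-refl a₂⋢a₁ ⟩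
      c₁               ≡⟨ sym (∨-meet-coatoms c₂-coatom x⊑c₁ x⋢c₂) ⟩
      x ∨L (c₂ ∧L c₁)  ≡⟨ cong (x ∨L_) (trans (L.∧-comm c₂ c₁) (sym ψ-bot)) ⟩
      x ∨L ψ bot       ∎
      where open ≡-Reasoning

    ψ-∨-bot₂ : ∀ {x} → ¬ x ⊑L c₁ → x ⊑L c₂ → ψ (φ x ∨U bot) ≡ x ∨L ψ bot
    ψ-∨-bot₂ {x} x⋢c₁ x⊑c₂ = begin
      ψ (φ x ∨U bot)   ≡⟨ cong ψ (trans (∨-bot (φ x)) (φ-a₂ x⋢c₁ x⊑c₂)) ⟩
      ψ a₂             ≡⟨ ψ-c₂ a₁⋢a₂ U.⊑-refl ⟩
      c₂               ≡⟨ sym (∨-meet-coatoms c₁-coatom x⊑c₂ x⋢c₁) ⟩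
      x ∨L (c₁ ∧L c₂)  ≡⟨ cong (x ∨L_) (sym ψ-bot) ⟩
      x ∨L ψ bot       ∎
      where open ≡-Reasoning

    ψ-∨-φ⊑ : ∀ x y → ψ (φ x ∨U y) ⊑L (x ∨L ψ y)
    ψ-∨-φ⊑ x y = cases (x L.≟ top) (x L.⊑? c₁) (x L.⊑? c₂) (a₁ U.⊑? y) (a₂ U.⊑? y)
      where
        cases : Dec (x ≡ top) → Dec (x ⊑L c₁) → Dec (x ⊑L c₂) → Dec (a₁ ⊑U y) → Dec (a₂ ⊑U y) →
                ψ (φ x ∨U y) ⊑L (x ∨L ψ y)
        cases (yes x≡top) _ _ _ _ =
          ψ-∨-top (L.⊑-antisym (top-max _) (L.⊑-trans (L.⊑-reflexive (sym x≡top)) (L.x≤x∨y _ _)))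
        cases (no x≢top) (no x⋢c₁) (no x⋢c₂) _ _ = ⊥-elim ([ x⋢c₁ , x⋢c₂ ]′ (below-c₁-or-c₂ x x≢top))
        cases (no _) (yes x⊑c₁) (yes x⊑c₂) _ _ = ψ-∨-≲ (inj₁ x⊑c₂ , inj₁ x⊑c₁)
        cases (no _) (yes x⊑c₁) (no _) (yes a₁⊑y) _ = ψ-∨-≲ (inj₂ a₁⊑y , inj₁ x⊑c₁)
        cases (no _) (no _) (yes x⊑c₂) _ (yes a₂⊑y) = ψ-∨-≲ (inj₁ x⊑c₂ , inj₂ a₂⊑y)
        cases (no _) (yes _) (no x⋢c₂) (no a₁⋢y) (yes a₂⊑y) =
          ψ-∨-top (trans (cong (x ∨L_) (ψ-c₂ a₁⋢y a₂⊑y)) (∨-coatom c₂-coatom x⋢c₂))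
        cases (no _) (no x⋢c₁) (yes _) (yes a₁⊑y) (no a₂⋢y) =
          ψ-∨-top (trans (cong (x ∨L_) (ψ-c₁ a₁⊑y a₂⋢y)) (∨-coatom c₁-coatom x⋢c₁))
        cases (no _) (yes x⊑c₁) (no x⋢c₂) (no a₁⋢y) (no a₂⋢y) =
          L.⊑-reflexive (subst (λ b → ψ (φ x ∨U b) ≡ x ∨L ψ b) (sym (bot-without-atoms a₁⋢y a₂⋢y)) (ψ-∨-bot₁ x⊑c₁ x⋢c₂))
        cases (no _) (no x⋢c₁) (yes x⊑c₂) (no a₁⋢y) (no a₂⋢y) =
          L.⊑-reflexive (subst (λ b → ψ (φ x ∨U b) ≡ x ∨L ψ b) (sym (bot-without-atoms a₁⋢y a₂⋢y)) (ψ-∨-bot₂ x⋢c₁ x⊑c₂))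

    ψ-∨ : ∀ x y → x ∨L ψ y ≡ ψ (φ x ∨U y)
    ψ-∨ x y = L.⊑-antisym
      (L.∨-least (L.⊑-trans (⊑ψφ x) (ψ-mono (U.x≤x∨y (φ x) y))) (ψ-mono (U.y≤x∨y (φ x) y)))
      (ψ-∨-φ⊑ x y)

    upper-below-a₁∨a₂ : ∀ {y} → Upper y → y ⊑U (a₁ ∨U a₂) → a₁ ⊑U y × a₂ ⊑U y
    upper-below-a₁∨a₂ {y} upper@(y≢bot , y≢a₁ , y≢a₂) y⊑a₁∨a₂ =
      [ (λ a₁⊑y → a₁⊑y , above-a₂ a₁⊑y (a₂ U.⊑? y)) , (λ a₂⊑y → above-a₁ a₂⊑y (a₁ U.⊑? y) , a₂⊑y) ]′
        (above-a₁-or-a₂ y y≢bot)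
      where
        above-a₂ : a₁ ⊑U y → Dec (a₂ ⊑U y) → a₂ ⊑U y
        above-a₂ _ (yes a₂⊑y) = a₂⊑y
        above-a₂ a₁⊑y (no a₂⋢y) = ⊥-elim (y≢a₁ (between-atoms a₂-atom a₁⊑y y⊑a₁∨a₂ a₂⋢y))
        above-a₁ : a₂ ⊑U y → Dec (a₁ ⊑U y) → a₁ ⊑U y
        above-a₁ _ (yes a₁⊑y) = a₁⊑y
        above-a₁ a₂⊑y (no a₁⋢y) = ⊥-elim (y≢a₂
          (between-atoms a₁-atom a₂⊑y (U.⊑-trans y⊑a₁∨a₂ (U.⊑-reflexive (U.∨-comm a₁ a₂))) a₁⋢y))

    embedL-ψ : ∀ {y} → y ⊑U (a₁ ∨U a₂) → embedL (ψ y) ≡ embedU y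
    embedL-ψ {y} y⊑a₁∨a₂ = cases (upper? y)
      where
        cases : Dec (Upper y) → embedL (ψ y) ≡ embedU y
        cases (no ¬upper) = embedL-ψ-non-upper ¬upper
        cases (yes upper) = begin
          embedL (ψ y)                     ≡⟨ cong embedL (ψ-top a₁⊑y a₂⊑y) ⟩
          embedL top                       ≡⟨ embedL-top ⟩
          high′ (a₁ ∨U a₂) upper-a₁∨a₂     ≡⟨ high-cong (U.⊑-antisym (U.∨-least a₁⊑y a₂⊑y) y⊑a₁∨a₂) ⟩
          high′ y upper                    ≡⟨ sym (embedU-upper y upper) ⟩
          embedU y                         ∎
          where
            open ≡-Reasoning
            a₁⊑y : a₁ ⊑U y
            a₁⊑y = proj₁ (upper-below-a₁∨a₂ upper y⊑a₁∨a₂)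
            a₂⊑y : a₂ ⊑U y
            a₂⊑y = proj₂ (upper-below-a₁∨a₂ upper y⊑a₁∨a₂)

    embedL-⊓-high : ∀ x y .{p q r} → embedL x ⊓ high y p q r ≡ embedL (x ∧L ψ y)
    embedL-⊓-high x y {p} {q} {r} = cases (x L.≟ top)
      where
        open ≡-Reasoning
        cases : Dec (x ≡ top) → embedL x ⊓ high y p q r ≡ embedL (x ∧L ψ y)
        cases (no x≢top) = trans (cong (_⊓ high y p q r) (embedL-low x x≢top)) (⊓-lowˡ x x≢top (high y p q r))
        cases (yes refl) = begin
          embedL top ⊓ high y p q r                 ≡⟨ cong (_⊓ high y p q r) embedL-top ⟩
          embedU ((a₁ ∨U a₂) ∧U y)                  ≡⟨ sym (embedL-ψ (U.x∧y≤x _ _)) ⟩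
          embedL (ψ ((a₁ ∨U a₂) ∧U y))              ≡⟨ cong embedL (ψ-∧ (a₁ ∨U a₂) y) ⟩
          embedL (ψ (a₁ ∨U a₂) ∧L ψ y)              ≡⟨ cong (λ t → embedL (t ∧L ψ y)) (ψ-top (U.x≤x∨y a₁ a₂) (U.y≤x∨y a₁ a₂)) ⟩
          embedL (top ∧L ψ y)                       ∎

    low-⊔-embedU : ∀ x .{x≢top} y → low x x≢top ⊔ embedU y ≡ embedU (φ x ∨U y)
    low-⊔-embedU x {x≢top} y = cases (upper? y)
      where
        open ≡-Reasoning
        cases : Dec (Upper y) → low x x≢top ⊔ embedU y ≡ embedU (φ x ∨U y)
        cases (yes upper) = trans (cong (low x x≢top ⊔_) (embedU-upper y upper))
                                  (sym (embedU-upper _ (upper-up upper (U.y≤x∨y (φ x) y))))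
        cases (no ¬upper) = begin
          low x x≢top ⊔ embedU y               ≡⟨ cong (low x x≢top ⊔_) (embedU-non-upper y ¬upper) ⟩
          embedL (x ∨L ψ y)                    ≡⟨ cong embedL (ψ-∨ x y) ⟩
          embedL (ψ (φ x ∨U y))                ≡⟨ embedL-ψ (U.∨-least (φ⊑a₁∨a₂ x) (non-upper⊑a₁∨a₂ ¬upper)) ⟩
          embedU (φ x ∨U y)                    ∎

    φ-∧-ψ : ∀ {x} → x ≢ top → ∀ y → φ (x ∧L ψ y) ≡ φ x ∧U y
    φ-∧-ψ {x} x≢top y = U.⊑-antisym
      (U.∧-greatest (φ-mono (L.x∧y≤x x (ψ y))) (⊑ψ⇒φ⊑ (L.x∧y≤y x (ψ y))))
      (cases (x L.⊑? ψ y) (x L.⊑? c₁) (x L.⊑? c₂) (a₁ U.⊑? y) (a₂ U.⊑? y))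
      where
        via-bot : φ x ∧U y ≡ bot → φ x ∧U y ⊑U φ (x ∧L ψ y)
        via-bot e = U.⊑-trans (U.⊑-reflexive e) (bot-min _)
        cases : Dec (x ⊑L ψ y) → Dec (x ⊑L c₁) → Dec (x ⊑L c₂) → Dec (a₁ ⊑U y) → Dec (a₂ ⊑U y) →
                φ x ∧U y ⊑U φ (x ∧L ψ y)
        cases (yes x⊑ψy) _ _ _ _ = U.⊑-trans (U.x∧y≤x _ _) (φ-mono (L.∧-greatest L.⊑-refl x⊑ψy))
        cases (no _) (no x⋢c₁) (no x⋢c₂) _ _ = ⊥-elim ([ x⋢c₁ , x⋢c₂ ]′ (below-c₁-or-c₂ x x≢top))
        cases (no _) (yes x⊑c₁) (yes x⊑c₂) _ _ =
          via-bot (U.⊑-antisym (U.⊑-trans (U.x∧y≤x _ _) (U.⊑-reflexive (φ-bot x⊑c₁ x⊑c₂))) (bot-min _))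
        cases (no x⋢ψy) (yes x⊑c₁) (no _) (yes a₁⊑y) _ = ⊥-elim (x⋢ψy (≲⇒⊑ψ (inj₂ a₁⊑y , inj₁ x⊑c₁)))
        cases (no _) (yes x⊑c₁) (no x⋢c₂) (no a₁⋢y) _ =
          via-bot (trans (cong (_∧U y) (φ-a₁ x⊑c₁ x⋢c₂)) (trans (U.∧-comm a₁ y) (∧-atom a₁-atom a₁⋢y)))
        cases (no x⋢ψy) (no _) (yes x⊑c₂) _ (yes a₂⊑y) = ⊥-elim (x⋢ψy (≲⇒⊑ψ (inj₁ x⊑c₂ , inj₂ a₂⊑y)))
        cases (no _) (no x⋢c₁) (yes x⊑c₂) _ (no a₂⋢y) =
          via-bot (trans (cong (_∧U y) (φ-a₂ x⋢c₁ x⊑c₂)) (trans (U.∧-comm a₂ y) (∧-atom a₂-atom a₂⋢y)))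

    sum-modular : Modular (VSum d) sum-lattice
    sum-modular (low x _) (low y _) (low z z≢top) (ll x⊑z) = begin
      embedL (x ∨L (y ∧L z))              ≡⟨ cong embedL (modularL x y z x⊑z) ⟩
      embedL ((x ∨L y) ∧L z)              ≡⟨ cong (λ t → embedL (t ∧L z)) (sym (projL-embedL _)) ⟩
      embedL (projL (embedL (x ∨L y)) ∧L z) ≡⟨ sym (⊓-lowʳ (embedL (x ∨L y)) z (¬-recompute z≢top)) ⟩
      embedL (x ∨L y) ⊓ low z z≢top       ∎
      where open ≡-Reasoning
    sum-modular v@(low x _) w@(high y _ _ _) (low z z≢top) (ll x⊑z) = begin
      embedL (x ∨L (ψ y ∧L z))            ≡⟨ cong embedL (modularL x (ψ y) z x⊑z) ⟩
      embedL ((x ∨L ψ y) ∧L z)            ≡⟨ cong (λ t → embedL (t ∧L z)) (ψ-∨ x y) ⟩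
      embedL (ψ (φ x ∨U y) ∧L z)          ≡⟨ sym (⊓-lowʳ (v ⊔ w) z (¬-recompute z≢top)) ⟩
      (v ⊔ w) ⊓ low z z≢top               ∎
      where open ≡-Reasoning
    sum-modular (low x _) (low y _) u@(high t _ _ _) x≼u = begin
      embedL (x ∨L (y ∧L ψ t))            ≡⟨ cong embedL (modularL x y (ψ t) (low-≼⁻ u x≼u)) ⟩
      embedL ((x ∨L y) ∧L ψ t)            ≡⟨ sym (embedL-⊓-high (x ∨L y) t) ⟩
      embedL (x ∨L y) ⊓ u                 ∎
      where open ≡-Reasoning
    sum-modular v@(low x _) (high y _ _ _) (high t _ _ _) x≼u = begin
      v ⊔ embedU (y ∧U t)                 ≡⟨ low-⊔-embedU x (y ∧U t) ⟩
      embedU (φ x ∨U (y ∧U t))            ≡⟨ cong embedU (modularU (φ x) y t (≼-high⁻ v x≼u)) ⟩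
      embedU ((φ x ∨U y) ∧U t)            ∎
      where open ≡-Reasoning
    sum-modular (high s p q r) w@(low y y≢top) u@(high t _ _ _) (hh s⊑t) = begin
      high s p q r ⊔ (w ⊓ u)              ≡⟨ ⊔-highˡ s (p , q , r) (w ⊓ u) ⟩
      embedU (s ∨U φ (y ∧L ψ t))          ≡⟨ cong (λ b → embedU (s ∨U b)) (φ-∧-ψ (¬-recompute y≢top) t) ⟩
      embedU (s ∨U (φ y ∧U t))            ≡⟨ cong embedU (modularU s (φ y) t s⊑t) ⟩
      embedU ((s ∨U φ y) ∧U t)            ∎
      where open ≡-Reasoning
    sum-modular (high s p q r) (high y _ _ _) (high t _ _ _) (hh s⊑t) = begin
      high s p q r ⊔ embedU (y ∧U t)      ≡⟨ ⊔-highˡ s (p , q , r) (embedU (y ∧U t)) ⟩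
      embedU (s ∨U projU (embedU (y ∧U t))) ≡⟨ cong (λ b → embedU (s ∨U b)) (projU-embedU _) ⟩
      embedU (s ∨U (y ∧U t))              ≡⟨ cong embedU (modularU s y t s⊑t) ⟩
      embedU ((s ∨U y) ∧U t)              ∎
      where open ≡-Reasoning

  embedL-∨ : ∀ x y → embedL (x ∨L y) ≡ embedL x ⊔ embedL y
  embedL-∨ x y = ≼-antisym
    (embedL-≼ _ _ (L.∨-least (≼-embedL x _ (⊔-upperˡ (embedL x) (embedL y)))
                             (≼-embedL y _ (⊔-upperʳ (embedL x) (embedL y)))))
    (⊔-least (embedL x) (embedL y) _ (embedL-≼ x _ (subst (x ⊑L_) (sym (projL-embedL _)) (L.x≤x∨y x y)))
                                      (embedL-≼ y _ (subst (y ⊑L_) (sym (projL-embedL _)) (L.y≤x∨y x y))))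

  embedL-∧ : ∀ x y → embedL (x ∧L y) ≡ embedL x ⊓ embedL y
  embedL-∧ x y = cases (x L.≟ top) (y L.≟ top)
    where
      open ≡-Reasoning
      cases : Dec (x ≡ top) → Dec (y ≡ top) → embedL (x ∧L y) ≡ embedL x ⊓ embedL y
      cases (no x≢top) _ = sym (begin
        embedL x ⊓ embedL y              ≡⟨ cong (_⊓ embedL y) (embedL-low x x≢top) ⟩
        low x x≢top ⊓ embedL y           ≡⟨ ⊓-lowˡ x x≢top (embedL y) ⟩
        embedL (x ∧L projL (embedL y))   ≡⟨ cong (λ t → embedL (x ∧L t)) (projL-embedL y) ⟩
        embedL (x ∧L y)                  ∎)
      cases (yes _) (no y≢top) = sym (begin
        embedL x ⊓ embedL y              ≡⟨ cong (embedL x ⊓_) (embedL-low y y≢top) ⟩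
        embedL x ⊓ low y y≢top           ≡⟨ ⊓-lowʳ (embedL x) y y≢top ⟩
        embedL (projL (embedL x) ∧L y)   ≡⟨ cong (λ t → embedL (t ∧L y)) (projL-embedL x) ⟩
        embedL (x ∧L y)                  ∎)
      cases (yes refl) (yes refl) = begin
        embedL (top ∧L top)                  ≡⟨ cong embedL (L.∧-idempotent top) ⟩
        embedL top                           ≡⟨ embedL-top ⟩
        high′ (a₁ ∨U a₂) upper-a₁∨a₂         ≡⟨ sym (embedU-upper _ upper-a₁∨a₂) ⟩
        embedU (a₁ ∨U a₂)                    ≡⟨ cong embedU (sym (U.∧-idempotent _)) ⟩
        embedU ((a₁ ∨U a₂) ∧U (a₁ ∨U a₂))    ≡⟨ cong₂ _⊓_ embedL-top embedL-top ⟨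
        embedL top ⊓ embedL top              ∎

  embedU-∨-non-upper : ∀ {y y′} → ¬ Upper y → ¬ Upper y′ → embedL (ψ y ∨L ψ y′) ≡ embedU (y ∨U y′)
  embedU-∨-non-upper {y} {y′} ¬upper ¬upper′ = cases (y U.⊑? y′) (y′ U.⊑? y)
    where
      cases : Dec (y ⊑U y′) → Dec (y′ ⊑U y) → embedL (ψ y ∨L ψ y′) ≡ embedU (y ∨U y′)
      cases (yes y⊑y′) _ = trans (cong embedL (L.x≤y⇒x∨y≈y (ψ-mono y⊑y′)))
                             (trans (embedL-ψ-non-upper ¬upper′) (cong embedU (sym (U.x≤y⇒x∨y≈y y⊑y′))))
      cases (no _) (yes y′⊑y) = trans (cong embedL (trans (L.∨-comm _ _) (L.x≤y⇒x∨y≈y (ψ-mono y′⊑y))))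
                             (trans (embedL-ψ-non-upper ¬upper) (cong embedU (sym (trans (U.∨-comm _ _) (U.x≤y⇒x∨y≈y y′⊑y)))))
      cases (no y⋢y′) (no y′⋢y) = atoms (not-upper ¬upper) (not-upper ¬upper′)
        where
          incomparable-atoms : ∀ {b b′} → b ≡ a₁ → b′ ≡ a₂ → embedL (ψ b ∨L ψ b′) ≡ embedU (b ∨U b′)
          incomparable-atoms refl refl = begin
            embedL (ψ a₁ ∨L ψ a₂)            ≡⟨ cong embedL (cong₂ _∨L_ (ψ-c₁ U.⊑-refl a₂⋢a₁) (ψ-c₂ a₁⋢a₂ U.⊑-refl)) ⟩
            embedL (c₁ ∨L c₂)                ≡⟨ cong embedL (∨-coatom c₂-coatom c₁⋢c₂) ⟩
            embedL top                       ≡⟨ embedL-top ⟩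
            high′ (a₁ ∨U a₂) upper-a₁∨a₂     ≡⟨ embedU-upper _ upper-a₁∨a₂ ⟨
            embedU (a₁ ∨U a₂)                ∎
            where open ≡-Reasoning
          atoms : y ≡ bot ⊎ y ≡ a₁ ⊎ y ≡ a₂ → y′ ≡ bot ⊎ y′ ≡ a₁ ⊎ y′ ≡ a₂ → embedL (ψ y ∨L ψ y′) ≡ embedU (y ∨U y′)
          atoms (inj₁ refl) _ = ⊥-elim (y⋢y′ (bot-min _))
          atoms _ (inj₁ refl) = ⊥-elim (y′⋢y (bot-min _))
          atoms (inj₂ (inj₁ y≡a₁)) (inj₂ (inj₁ y′≡a₁)) = ⊥-elim (y⋢y′ (U.⊑-reflexive (trans y≡a₁ (sym y′≡a₁))))
          atoms (inj₂ (inj₂ y≡a₂)) (inj₂ (inj₂ y′≡a₂)) = ⊥-elim (y⋢y′ (U.⊑-reflexive (trans y≡a₂ (sym y′≡a₂))))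
          atoms (inj₂ (inj₁ y≡a₁)) (inj₂ (inj₂ y′≡a₂)) = incomparable-atoms y≡a₁ y′≡a₂
          atoms (inj₂ (inj₂ y≡a₂)) (inj₂ (inj₁ y′≡a₁)) =
            trans (cong embedL (L.∨-comm _ _)) (trans (incomparable-atoms y′≡a₁ y≡a₂) (cong embedU (U.∨-comm _ _)))

  embedU-∨ : ∀ y y′ → embedU (y ∨U y′) ≡ embedU y ⊔ embedU y′
  embedU-∨ y y′ = cases (upper? y) (upper? y′)
    where
      open ≡-Reasoning
      cases : Dec (Upper y) → Dec (Upper y′) → embedU (y ∨U y′) ≡ embedU y ⊔ embedU y′
      cases (yes upper) _ = sym (begin
        embedU y ⊔ embedU y′                   ≡⟨ cong (_⊔ embedU y′) (embedU-upper y upper) ⟩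
        high′ y upper ⊔ embedU y′              ≡⟨ ⊔-highˡ y upper (embedU y′) ⟩
        embedU (y ∨U projU (embedU y′))        ≡⟨ cong (λ t → embedU (y ∨U t)) (projU-embedU y′) ⟩
        embedU (y ∨U y′)                       ∎)
      cases (no _) (yes upper′) = sym (begin
        embedU y ⊔ embedU y′                   ≡⟨ cong (embedU y ⊔_) (embedU-upper y′ upper′) ⟩
        embedU y ⊔ high′ y′ upper′             ≡⟨ ⊔-highʳ (embedU y) y′ ⟩
        embedU (projU (embedU y) ∨U y′)        ≡⟨ cong (λ t → embedU (t ∨U y′)) (projU-embedU y) ⟩
        embedU (y ∨U y′)                       ∎)
      cases (no ¬upper) (no ¬upper′) = sym (begin
        embedU y ⊔ embedU y′                   ≡⟨ cong₂ _⊔_ (embedU-non-upper y ¬upper) (embedU-non-upper y′ ¬upper′) ⟩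
        embedL (ψ y ∨L ψ y′)                   ≡⟨ embedU-∨-non-upper ¬upper ¬upper′ ⟩
        embedU (y ∨U y′)                       ∎)

  embedU-∧ : ∀ y y′ → embedU (y ∧U y′) ≡ embedU y ⊓ embedU y′
  embedU-∧ y y′ = cases (upper? y) (upper? y′)
    where
      open ≡-Reasoning
      cases : Dec (Upper y) → Dec (Upper y′) → embedU (y ∧U y′) ≡ embedU y ⊓ embedU y′
      cases (yes upper) (yes upper′) = sym (cong₂ _⊓_ (embedU-upper y upper) (embedU-upper y′ upper′))
      cases (no ¬upper) _ = sym (begin
        embedU y ⊓ embedU y′                   ≡⟨ cong (_⊓ embedU y′) (embedU-non-upper y ¬upper) ⟩
        low (ψ y) (ψ≢top ¬upper) ⊓ embedU y′   ≡⟨ ⊓-lowˡ (ψ y) (ψ≢top ¬upper) (embedU y′) ⟩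
        embedL (ψ y ∧L projL (embedU y′))      ≡⟨ cong (λ t → embedL (ψ y ∧L t)) (projL-embedU y′) ⟩
        embedL (ψ y ∧L ψ y′)                   ≡⟨ cong embedL (ψ-∧ y y′) ⟨
        embedL (ψ (y ∧U y′))                   ≡⟨ embedL-ψ-non-upper (λ upper → ¬upper (upper-up upper (U.x∧y≤x y y′))) ⟩
        embedU (y ∧U y′)                       ∎)
      cases (yes _) (no ¬upper′) = sym (begin
        embedU y ⊓ embedU y′                   ≡⟨ cong (embedU y ⊓_) (embedU-non-upper y′ ¬upper′) ⟩
        embedU y ⊓ low (ψ y′) (ψ≢top ¬upper′)  ≡⟨ ⊓-lowʳ (embedU y) (ψ y′) (ψ≢top ¬upper′) ⟩
        embedL (projL (embedU y) ∧L ψ y′)      ≡⟨ cong (λ t → embedL (t ∧L ψ y′)) (projL-embedU y) ⟩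
        embedL (ψ y ∧L ψ y′)                   ≡⟨ cong embedL (ψ-∧ y y′) ⟨
        embedL (ψ (y ∧U y′))                   ≡⟨ embedL-ψ-non-upper (λ upper → ¬upper′ (upper-up upper (U.x∧y≤y y y′))) ⟩
        embedU (y ∧U y′)                       ∎)

  sum-not-vertical : ¬ IsVerticalSum L → ¬ IsVerticalSum U → ¬ IsVerticalSum (VSum d)
  sum-not-vertical ¬vL _ (low t t≢top , comparable , (low x _ , ll x⊑t , x≢t) , _) =
    ¬vL (t , comparableL , (x , x⊑t , x≢t ∘ low-cong) , (top , top-max t , ¬-recompute t≢top))
    where
      comparableL : ∀ x → x ⊑L t ⊎ t ⊑L x
      comparableL x with x L.≟ top
      ... | yes refl   = inj₂ (top-max t)
      ... | no x≢top with comparable (low x x≢top)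
      ...   | inj₁ (ll x⊑t) = inj₁ x⊑t
      ...   | inj₂ (ll t⊑x) = inj₂ t⊑x
  sum-not-vertical _ ¬vU (high s p q r , comparable , _ , (high y _ _ _ , hh s⊑y , s≢y)) =
    ¬vU (s , comparableU , (bot , bot-min s , ¬-recompute p ∘ sym) , (y , s⊑y , s≢y ∘ high-cong))
    where
      a₁⊑s : a₁ ⊑U s
      a₁⊑s with comparable (low c₁ c₁≢top)
      ... | inj₁ c₁≼s = [ ⊥-elim ∘ c₁⋢c₂ , (λ a₁⊑s → a₁⊑s) ]′ (proj₁ (⊑ψ⇒≲ (low-≼⁻ _ c₁≼s)))
      ... | inj₂ ()
      a₂⊑s : a₂ ⊑U s
      a₂⊑s with comparable (low c₂ c₂≢top)
      ... | inj₁ c₂≼s = [ ⊥-elim ∘ c₂⋢c₁ , (λ a₂⊑s → a₂⊑s) ]′ (proj₂ (⊑ψ⇒≲ (low-≼⁻ _ c₂≼s)))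
      ... | inj₂ ()
      non-upper⊑s : ∀ {y} → y ≡ bot ⊎ y ≡ a₁ ⊎ y ≡ a₂ → y ⊑U s
      non-upper⊑s (inj₁ refl)        = bot-min s
      non-upper⊑s (inj₂ (inj₁ refl)) = a₁⊑s
      non-upper⊑s (inj₂ (inj₂ refl)) = a₂⊑s
      comparableU : ∀ y → y ⊑U s ⊎ s ⊑U y
      comparableU y with upper? y
      ... | no ¬upper = inj₁ (non-upper⊑s (not-upper ¬upper))
      ... | yes upper with comparable (high′ y upper)
      ...   | inj₁ (hh y⊑s) = inj₁ y⊑s
      ...   | inj₂ (hh s⊑y) = inj₂ s⊑y

  L-not-vertical : ¬ IsVerticalSum (VSum d) → ¬ IsVerticalSum L
  L-not-vertical ¬vV (t , comparable , (x , x⊑t , x≢t) , (y , t⊑y , t≢y)) =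
    ¬vV (low t t≢top , comparableV , (low x x≢top , ll x⊑t , x≢t ∘ cong projL) , (low c₁ c₁≢top , ll t⊑c₁ , t≢c₁ ∘ cong projL))
    where
      t≢top : t ≢ top
      t≢top refl = t≢y (L.⊑-antisym t⊑y (top-max y))
      x≢top : x ≢ top
      x≢top = ≢top-down x⊑t t≢top
      below-coatom : ∀ {c c′} → _⋖ₛ_ L c top → ¬ c′ ⊑L c → ¬ c ⊑L c′ → t ⊑L c
      below-coatom {c} {c′} c⋖top c′⋢c c⋢c′ with comparable c
      ... | inj₂ t⊑c = t⊑c
      ... | inj₁ c⊑t with coatom-maximal c⋖top c⊑t t≢top
      ...   | refl = [ (λ c′⊑t → ⊥-elim (c′⋢c c′⊑t)) , (λ t⊑c′ → ⊥-elim (c⋢c′ t⊑c′)) ]′ (comparable c′)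
      t⊑c₁ : t ⊑L c₁
      t⊑c₁ = below-coatom c₁-coatom c₂⋢c₁ c₁⋢c₂
      t⊑c₂ : t ⊑L c₂
      t⊑c₂ = below-coatom c₂-coatom c₁⋢c₂ c₂⋢c₁
      t≢c₁ : t ≢ c₁
      t≢c₁ refl = c₁⋢c₂ t⊑c₂
      comparableV : ∀ v → v ≼ low t t≢top ⊎ low t t≢top ≼ v
      comparableV (low x′ _) = Sum.map ll ll (comparable x′)
      comparableV v@(high y′ _ _ _) = inj₂ (low-≼⁺ v (≲⇒⊑ψ (inj₁ t⊑c₂ , inj₁ t⊑c₁)))

  U-not-vertical : ¬ IsVerticalSum (VSum d) → ¬ IsVerticalSum U
  U-not-vertical ¬vV (s , comparable , (y , y⊑s , y≢s) , (y′ , s⊑y′ , s≢y′)) =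
    ¬vV (high′ s upper , comparableV , (low c₁ c₁≢top , low-≼⁺ _ c₁⊑ψs , λ ()) ,
         (high′ y′ (upper-up upper s⊑y′) , hh s⊑y′ , s≢y′ ∘ cong projU))
    where
      s≢bot : s ≢ bot
      s≢bot refl = y≢s (U.⊑-antisym y⊑s (bot-min y))
      above-atom : ∀ {a a′} → _⋖ₛ_ U bot a → ¬ a′ ⊑U a → ¬ a ⊑U a′ → a ⊑U s
      above-atom {a} {a′} bot⋖a a′⋢a a⋢a′ with comparable a
      ... | inj₁ a⊑s = a⊑s
      ... | inj₂ s⊑a with atom-minimal bot⋖a s⊑a s≢bot
      ...   | refl = [ (λ a′⊑s → ⊥-elim (a′⋢a a′⊑s)) , (λ s⊑a′ → ⊥-elim (a⋢a′ s⊑a′)) ]′ (comparable a′)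
      a₁⊑s : a₁ ⊑U s
      a₁⊑s = above-atom a₁-atom a₂⋢a₁ a₁⋢a₂
      a₂⊑s : a₂ ⊑U s
      a₂⊑s = above-atom a₂-atom a₁⋢a₂ a₂⋢a₁
      upper : Upper s
      upper = upper-above-atoms a₁⊑s a₂⊑s
      c₁⊑ψs : c₁ ⊑L ψ s
      c₁⊑ψs = L.⊑-trans (top-max c₁) (L.⊑-reflexive (sym (ψ-top a₁⊑s a₂⊑s)))
      comparableV : ∀ v → v ≼ high′ s upper ⊎ high′ s upper ≼ v
      comparableV v@(low x _)       = inj₁ (low-≼⁺ (high′ s upper) (L.⊑-trans (top-max x) (L.⊑-reflexive (sym (ψ-top a₁⊑s a₂⊑s)))))
      comparableV (high y″ _ _ _) = Sum.map hh hh (comparable y″)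

  V↔parts : V ↔ ([ x ∈ Carrier L ∣ x ≢ top ] ⊎ [ y ∈ Carrier U ∣ Upper y ])
  V↔parts = mk↔ₛ′ to from (λ { (inj₁ _) → refl ; (inj₂ _) → refl }) (λ { (low _ _) → refl ; (high _ _ _ _) → refl })
    where
      to : V → [ x ∈ Carrier L ∣ x ≢ top ] ⊎ [ y ∈ Carrier U ∣ Upper y ]
      to (low x x≢top) = inj₁ (x , [ x≢top ])
      to (high y p q r) = inj₂ (y , [ (p , q , r) ])
      from : [ x ∈ Carrier L ∣ x ≢ top ] ⊎ [ y ∈ Carrier U ∣ Upper y ] → V
      from (inj₁ (x , [ x≢top ])) = low x x≢top
      from (inj₂ (y , [ upper ])) = high′ y upper

  sum-finite : Finite (VSum d)
  sum-finite with k , eL ← refinement-finite (proj₂ L-fin) (λ x → ¬? (x L.≟ top))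
            | m , eU ← refinement-finite (proj₂ U-fin) upper?
            = k + m , ↔-trans V↔parts (↔-trans (eL ⊎-↔ eU) (↔-sym Fin.+↔⊎))

  L-modular : Modular (VSum d) sum-lattice → Modular L L-lat
  L-modular = modular-sublattice L-lat sum-lattice embedL projL projL-embedL embedL-∨ embedL-∧

  U-modular : Modular (VSum d) sum-lattice → Modular U U-lat
  U-modular = modular-sublattice U-lat sum-lattice embedU projU projU-embedU embedU-∨ embedU-∧

open VerticalTwoSum

lemma5 : TwoSummable FinModVI
lemma5 = record
  { members-vi     = λ _ (_ , _ , vi) → vi
  ; members-graded = λ _ (fin , (lat , modular) , _) → FiniteLattice.graded lat fin modular
  ; C1             = λ _ _ → sum-in-family
  ; C2             = λ _ _ → parts-in-family
  }
  where
    sum-in-family : ∀ {L U} (d : VSumData L U) → FinModVI L → FinModVI U → FinModVI (VSum d)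
    sum-in-family d (_ , (latL , modularL) , _ , ¬vL) (_ , (latU , modularU) , _ , ¬vU) =
      sum-finite d ,
      (sum-lattice d , sum-modular d (modular-irrelevant latL L-lat modularL) (modular-irrelevant latU U-lat modularU)) ,
      (sum-lattice d , sum-not-vertical d ¬vL ¬vU)
      where open VSumData d

    parts-in-family : ∀ {L U} (d : VSumData L U) → FinModVI (VSum d) → FinModVI L × FinModVI U
    parts-in-family d (_ , (lat , modular) , _ , ¬vV) =
      (L-fin , (L-lat , L-modular d modular-sum) , L-lat , L-not-vertical d ¬vV) ,
      (U-fin , (U-lat , U-modular d modular-sum) , U-lat , U-not-vertical d ¬vV)
      where
        open VSumData d
        modular-sum : Modular (VSum d) (sum-lattice d)
        modular-sum = modular-irrelevant lat (sum-lattice d) modular
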